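{- For every odd $n\ge1$, the number $E^1_{n,(n-1)/2}$ of unlabeled simplex time-consistent galled trees with $n$ leaves and exactly $\frac{n-1}{2}$ galls (the maximal possible number) equals the number $U_{(n+1)/2}$ of unlabeled (non-plane) rooted binary trees with $\frac{n+1}{2}$ leaves.
   Context: A rooted binary phylogenetic network is a finite simple directed acyclic graph with a unique root (in-degree 0, out-degree 2), tree nodes (in-degree 1, out-degree 2), leaves (in-degree 1, out-degree 0), and reticulation nodes (in-degree 2, out-degree 1); the single-vertex graph is regarded as the unique network with one leaf. A reticulation cycle is a pair of directed paths with common start and end vertices that are otherwise vertex-disjoint. A galled tree is such a network in which every vertex lies in at most one reticulation cycle; these cycles are galls, each with a top node (common start vertex) and a reticulation node (common end vertex). A galled tree is time-consistent if for every gall each of the two paths from its top node to its reticulation node has at least two edges, and simplex if the unique child of every reticulation node is a leaf. "Unlabeled" means counted up to isomorphism of directed graphs (non-plane). -}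

module Defs where

open import Data.Nat using (ℕ; zero; suc; _+_; _*_)
open import Data.Bool using (Bool; true; false)
open import Data.Fin using (Fin)
open import Data.List using (List; []; _∷_; map; allFin)
open import Data.Nat.ListAction using (sum)
open import Data.List.Membership.Propositional using (_∈_)
open import Data.Vec using (Vec; lookup)
open import Data.Product using (Σ; ∃; _×_; _,_; proj₁; proj₂)
open import Data.Sum using (_⊎_)
open import Data.Empty using (⊥)
open import Relation.Nullary using (¬_)
open import Relation.Binary.PropositionalEquality using (_≡_; _≢_)
open import Function.Bundles using (_↔_; Inverse)

-- Finite simple directed graphs on vertex set Fin V, given by their
-- adjacency (edge) relation: G u v ≡ true iff there is an edge u → v.

Digraph : ℕ → Set
Digraph V = Fin V → Fin V → Bool

Graph : Set
Graph = Σ ℕ Digraph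

b2n : Bool → ℕ
b2n true  = 1
b2n false = 0

indeg : ∀ {V} → Digraph V → Fin V → ℕ
indeg {V} G v = sum (map (λ u → b2n (G u v)) (allFin V))

outdeg : ∀ {V} → Digraph V → Fin V → ℕ
outdeg {V} G v = sum (map (λ w → b2n (G v w)) (allFin V))

-- Chain G s xs t : a directed path s → x₁ → … → x_k → t whose interior
-- vertices are xs = x₁ ∷ … ∷ x_k (at least one edge).
data Chain {V} (G : Digraph V) : Fin V → List (Fin V) → Fin V → Set where
  direct : ∀ {s t} → G s t ≡ true → Chain G s [] t
  step   : ∀ {s x xs t} → G s x ≡ true → Chain G x xs t → Chain G s (x ∷ xs) t

-- Simple: no loops (no multi-edges by construction).
NoLoops : ∀ {V} → Digraph V → Set
NoLoops {V} G = (v : Fin V) → G v v ≡ false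

Acyclic : ∀ {V} → Digraph V → Set
Acyclic {V} G = (v : Fin V) (xs : List (Fin V)) → ¬ Chain G v xs v

-- Allowed vertex types in a rooted binary phylogenetic network
-- (in-degree, out-degree): root (0,2), tree node (1,2), leaf (1,0),
-- reticulation (2,1).
AllowedType : ∀ {V} → Digraph V → Fin V → Set
AllowedType G v =
  (indeg G v ≡ 0 × outdeg G v ≡ 2) ⊎
  (indeg G v ≡ 1 × outdeg G v ≡ 2) ⊎
  (indeg G v ≡ 1 × outdeg G v ≡ 0) ⊎
  (indeg G v ≡ 2 × outdeg G v ≡ 1)

-- Rooted binary phylogenetic network; the single-vertex graph is the
-- unique network with one leaf.
IsNetwork : Graph → Set
IsNetwork (V , G) =
  NoLoops G × Acyclic G ×
  ( V ≡ 1
  ⊎ ( ((v : Fin V) → AllowedType G v)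
    × (Σ (Fin V) λ r → indeg G r ≡ 0)
    × ((u v : Fin V) → indeg G u ≡ 0 → indeg G v ≡ 0 → u ≡ v)))

leafCount : Graph → ℕ
leafCount (V , G) = sum (map (λ v → b2n (isLeaf (outdeg G v))) (allFin V))
  where
  isLeaf : ℕ → Bool
  isLeaf zero    = true
  isLeaf (suc _) = false

record RetCycle {V} (G : Digraph V) : Set where
  field
    top ret  : Fin V
    p q      : List (Fin V)
    pathP    : Chain G top p ret
    pathQ    : Chain G top q ret
    disjoint : (x : Fin V) → x ∈ p → x ∈ q → ⊥
    distinct : ¬ (p ≡ [] × q ≡ [])
open RetCycle public

OnCycle : ∀ {V} {G : Digraph V} → Fin V → RetCycle G → Set
OnCycle v C = v ≡ top C ⊎ v ≡ ret C ⊎ v ∈ p C ⊎ v ∈ q C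

SameCycle : ∀ {V} {G : Digraph V} → RetCycle G → RetCycle G → Set
SameCycle C D =
  top C ≡ top D × ret C ≡ ret D ×
  ((p C ≡ p D × q C ≡ q D) ⊎ (p C ≡ q D × q C ≡ p D))

IsGalledTree : Graph → Set
IsGalledTree (V , G) =
  IsNetwork (V , G) ×
  ((v : Fin V) (C D : RetCycle G) → OnCycle v C → OnCycle v D → SameCycle C D)

HasGallCount : Graph → ℕ → Set
HasGallCount (V , G) k =
  Σ (Vec (RetCycle G) k) λ cs →
    ((i j : Fin k) → i ≢ j → ¬ SameCycle (lookup cs i) (lookup cs j)) ×
    ((C : RetCycle G) → ∃ λ i → SameCycle C (lookup cs i))

TimeConsistent : Graph → Set
TimeConsistent (V , G) = (C : RetCycle G) → ¬ (p C ≡ []) × ¬ (q C ≡ [])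

Simplex : Graph → Set
Simplex (V , G) =
  (r c : Fin V) → indeg G r ≡ 2 → G r c ≡ true → outdeg G c ≡ 0

IsBinaryTree : Graph → Set
IsBinaryTree (V , G) = IsNetwork (V , G) × ((v : Fin V) → ¬ (indeg G v ≡ 2))

Iso : Graph → Graph → Set
Iso (V , G) (W , H) =
  Σ (Fin V ↔ Fin W) λ f →
    (u v : Fin V) → G u v ≡ H (Inverse.to f u) (Inverse.to f v)

ClassCount : (Graph → Set) → ℕ → Set
ClassCount P k =
  Σ (Vec Graph k) λ reps →
    ((i : Fin k) → P (lookup reps i)) ×
    ((i j : Fin k) → i ≢ j → ¬ Iso (lookup reps i) (lookup reps j)) ×
    ((H : Graph) → P H → ∃ λ i → Iso H (lookup reps i))

SimplexTCGalled : ℕ → ℕ → Graph → Set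
SimplexTCGalled n k H =
  IsGalledTree H × TimeConsistent H × Simplex H ×
  leafCount H ≡ n × HasGallCount H k

BinTree : ℕ → Graph → Set
BinTree m H = IsBinaryTree H × leafCount H ≡ m

{-# OPTIONS --safe #-}
module Submission where

-- Both families are classified by binary tree shapes taken up to swapping subtrees. A shape s yields the binary
-- tree treeGraph s and the galled tree galledGraph s, in which every internal node becomes a diamond-shaped gall
-- (top, two sides, reticulation, and a leaf below the reticulation) whose sides carry the two subtrees. Reading the
-- shape off below the root is invariant under isomorphism and recovers s up to swaps, so distinct classes of shapes
-- give non-isomorphic graphs. Conversely every binary tree is a treeGraph. For a simplex time-consistent galled tree
-- with 2m+1 leaves and m galls, every reticulation lies on one of the galls, so there are m reticulations, and degree
-- counting gives exactly 3m vertices of out-degree 2. Each gall contains at least three of them (its top and a vertex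
-- on each side) and the galls are disjoint, so every gall is a diamond and these vertices are all tops and sides of
-- galls; hence the galled tree is galledGraph s for the shape recorded by its galls. Both counts therefore equal the
-- number of shapes with m+1 leaves up to swaps.

module Counting where

  open import Data.Empty using (⊥-elim)
  open import Data.Fin using (Fin; zero; suc)
  import Data.Fin.Properties as Fin
  open import Data.List using (List; []; _∷_; map; tabulate; allFin; filter; length)
  open import Data.List.Membership.Propositional using (_∈_; _∉_)
  open import Data.List.Membership.Propositional.Properties using (∈-filter⁺; ∈-filter⁻; ∈-allFin; ∈-map⁺; ∈-map⁻)
  import Data.List.Membership.DecPropositional as DecMembership
  open import Data.List.Properties using (map-tabulate)
  open import Data.List.Relation.Unary.All.Properties using (All¬⇒¬Any)
  open import Data.List.Relation.Unary.All using ([]; _∷_)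
  open import Data.List.Relation.Unary.AllPairs using ([]; _∷_)
  open import Data.List.Relation.Unary.Any using (here; there)
  open import Data.List.Relation.Unary.Unique.Propositional using (Unique)
  import Data.List.Relation.Unary.Unique.Propositional.Properties as Unique
  open import Data.Nat using (ℕ; zero; suc; _+_; _*_; _≤_; _<_; z≤n)
  open import Data.Nat.ListAction using (sum)
  open import Data.Nat.Properties using (+-0-commutativeMonoid; ≤-refl; +-mono-≤; +-mono-<-≤; +-mono-≤-<; <-irrefl; <-≤-trans)
  open import Data.Product using (Σ; _×_; _,_; proj₂)
  open import Data.Sum using (_⊎_; inj₁; inj₂)
  open import Function.Bundles using (mk⇔)
  open import Relation.Binary.PropositionalEquality using (_≡_; _≢_; refl; sym; trans; cong; cong₂; subst; subst₂; module ≡-Reasoning)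
  open import Relation.Nullary using (does; yes; no)
  open import Relation.Nullary.Decidable using (decidable-stable; dec-true; dec-false; does-⇔)
  open import Relation.Unary using (Decidable)

  open import Algebra.Properties.CommutativeMonoid.Sum +-0-commutativeMonoid public
    using (sum-cong-≗; ∑-distrib-+; ∑-comm; ∑-permute) renaming (sum to ∑)

  open import Defs

  ∑-tabulate : ∀ {n} (f : Fin n → ℕ) → sum (tabulate f) ≡ ∑ f
  ∑-tabulate {zero}  f = refl
  ∑-tabulate {suc n} f = cong (f zero +_) (∑-tabulate (λ i → f (suc i)))

  sum-map-allFin : ∀ n (f : Fin n → ℕ) → sum (map f (allFin n)) ≡ ∑ f
  sum-map-allFin n f = trans (cong sum (map-tabulate (λ i → i) f)) (∑-tabulate f)

  ∑-const : ∀ n c → ∑ {n} (λ _ → c) ≡ n * c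
  ∑-const zero    c = refl
  ∑-const (suc n) c = cong (c +_) (∑-const n c)

  ∑-zero : ∀ n → ∑ {n} (λ _ → 0) ≡ 0
  ∑-zero zero    = refl
  ∑-zero (suc n) = ∑-zero n

  ∑-mono-≤ : ∀ {n} {f g : Fin n → ℕ} → (∀ i → f i ≤ g i) → ∑ f ≤ ∑ g
  ∑-mono-≤ {zero}  f≤g = z≤n
  ∑-mono-≤ {suc n} f≤g = +-mono-≤ (f≤g zero) (∑-mono-≤ (λ i → f≤g (suc i)))

  ∑-mono-< : ∀ {n} {f g : Fin n → ℕ} → (∀ i → f i ≤ g i) → ∀ j → f j < g j → ∑ f < ∑ g
  ∑-mono-< f≤g zero    fj<gj = +-mono-<-≤ fj<gj (∑-mono-≤ (λ i → f≤g (suc i)))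
  ∑-mono-< f≤g (suc j) fj<gj = +-mono-≤-< (f≤g zero) (∑-mono-< (λ i → f≤g (suc i)) j fj<gj)

  record ListsExactly {A : Set} (P : A → Set) (xs : List A) : Set where
    field
      unique   : Unique xs
      sound    : ∀ {x} → x ∈ xs → P x
      complete : ∀ {x} → P x → x ∈ xs
  open ListsExactly public

  ListsExactly-map : ∀ {A B : Set} {P : A → Set} {Q : B → Set} {xs} (φ : A → B) →
    (∀ {a b} → φ a ≡ φ b → a ≡ b) → (∀ {a} → P a → Q (φ a)) → (∀ {a} → Q (φ a) → P a) →
    (∀ {y} → Q y → Σ A λ a → y ≡ φ a) → ListsExactly P xs → ListsExactly Q (map φ xs)
  ListsExactly-map {A} {B} {P} {Q} {xs} φ injective P⇒Q Q⇒P image L = record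
    { unique   = Unique.map⁺ injective (unique L)
    ; sound    = λ y∈ → sound′ (∈-map⁻ φ y∈)
    ; complete = complete′
    }
    where
    sound′ : ∀ {y} → Σ A (λ a → a ∈ xs × y ≡ φ a) → Q y
    sound′ (a , a∈ , refl) = P⇒Q (sound L a∈)
    complete′ : ∀ {y} → Q y → y ∈ map φ xs
    complete′ Qy with image Qy
    ... | a , refl = ∈-map⁺ φ (complete L (Q⇒P Qy))

  ∈-pair⁻ : ∀ {A : Set} {x a b : A} → x ∈ a ∷ b ∷ [] → x ≡ a ⊎ x ≡ b
  ∈-pair⁻ (here x≡a)         = inj₁ x≡a
  ∈-pair⁻ (there (here x≡b)) = inj₂ x≡b

  Unique-pair : ∀ {A : Set} {a b : A} → a ≢ b → Unique (a ∷ b ∷ [])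
  Unique-pair a≢b = (a≢b ∷ []) ∷ [] ∷ []

  Unique-pair⁻ : ∀ {A : Set} {a b : A} → Unique (a ∷ b ∷ []) → a ≢ b
  Unique-pair⁻ ((a≢b ∷ []) ∷ _) = a≢b

  length≡0 : ∀ {A : Set} {xs : List A} → length xs ≡ 0 → xs ≡ []
  length≡0 {xs = []} _ = refl

  length≡1 : ∀ {A : Set} {xs : List A} → length xs ≡ 1 → Σ A λ a → xs ≡ a ∷ []
  length≡1 {xs = a ∷ []} _ = a , refl

  length≡2 : ∀ {A : Set} {xs : List A} → length xs ≡ 2 → Σ A λ a → Σ A λ b → xs ≡ a ∷ b ∷ []
  length≡2 {xs = a ∷ b ∷ []} _ = a , b , refl

  Unique-length≡1 : ∀ {A : Set} {xs : List A} → length xs ≡ 1 → Unique xs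
  Unique-length≡1 {xs = _ ∷ []} _ = [] ∷ []

  ListsExactly-singleton : ∀ {A : Set} {P : A → Set} {a x} → ListsExactly P (a ∷ []) → P x → x ≡ a
  ListsExactly-singleton L Px with complete L Px
  ... | here x≡a = x≡a

  ListsExactly-pair : ∀ {A : Set} {P : A → Set} {a b x} → ListsExactly P (a ∷ b ∷ []) → P x → x ≡ a ⊎ x ≡ b
  ListsExactly-pair L Px = ∈-pair⁻ (complete L Px)

  ListsExactly-swap : ∀ {A : Set} {P : A → Set} {a b} → ListsExactly P (a ∷ b ∷ []) → ListsExactly P (b ∷ a ∷ [])
  ListsExactly-swap L = record
    { unique   = Unique-pair (λ b≡a → Unique-pair⁻ (unique L) (sym b≡a))
    ; sound    = λ x∈ → sound L (swap-∈ x∈)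
    ; complete = λ Px → swap-∈ (complete L Px)
    }
    where
    swap-∈ : ∀ {A : Set} {x a b : A} → x ∈ a ∷ b ∷ [] → x ∈ b ∷ a ∷ []
    swap-∈ (here x≡a)         = there (here x≡a)
    swap-∈ (there (here x≡b)) = here x≡b

  ListsExactly-pair-unique : ∀ {A : Set} {P : A → Set} {a b c d} →
    ListsExactly P (a ∷ b ∷ []) → ListsExactly P (c ∷ d ∷ []) → (c ≡ a × d ≡ b) ⊎ (c ≡ b × d ≡ a)
  ListsExactly-pair-unique Lab Lcd
    with ListsExactly-pair Lab (sound Lcd (here refl)) | ListsExactly-pair Lab (sound Lcd (there (here refl)))
  ... | inj₁ refl | inj₂ refl = inj₁ (refl , refl)
  ... | inj₂ refl | inj₁ refl = inj₂ (refl , refl)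
  ... | inj₁ refl | inj₁ refl = ⊥-elim (Unique-pair⁻ (unique Lcd) refl)
  ... | inj₂ refl | inj₂ refl = ⊥-elim (Unique-pair⁻ (unique Lcd) refl)

  Unique-map-injective : ∀ {A B : Set} {f : A → B} {xs} → Unique (map f xs) →
    ∀ {x y} → x ∈ xs → y ∈ xs → f x ≡ f y → x ≡ y
  Unique-map-injective     _         (here refl) (here refl) _     = refl
  Unique-map-injective {f = f} {_ ∷ xs} (fx∉ ∷ _) (here refl) (there y∈) fx≡fy =
    ⊥-elim (All¬⇒¬Any fx∉ (subst (_∈ map f xs) (sym fx≡fy) (∈-map⁺ f y∈)))
  Unique-map-injective {f = f} {_ ∷ xs} (fy∉ ∷ _) (there x∈) (here refl) fx≡fy =
    ⊥-elim (All¬⇒¬Any fy∉ (subst (_∈ map f xs) fx≡fy (∈-map⁺ f x∈)))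
  Unique-map-injective     (_ ∷ u)   (there x∈) (there y∈) fx≡fy = Unique-map-injective u x∈ y∈ fx≡fy

  count : ∀ {n} {P : Fin n → Set} → Decidable P → ℕ
  count P? = ∑ (λ i → b2n (does (P? i)))

  count-point : ∀ {n} (x : Fin n) → count (Fin._≟ x) ≡ 1
  count-point {suc n} zero    = cong suc (∑-zero n)
  count-point {suc n} (suc x) = count-point x

  module _ {n : ℕ} where
    open DecMembership (Fin._≟_ {n}) using (_∈?_)

    private
      b2n-∈-∷ : ∀ {x xs} → x ∉ xs → ∀ i →
        b2n (does (i ∈? (x ∷ xs))) ≡ b2n (does (i Fin.≟ x)) + b2n (does (i ∈? xs))
      b2n-∈-∷ {x} {xs} x∉xs i with i Fin.≟ x
      ... | no _ = refl
      ... | yes refl with x ∈? xs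
      ...   | no _     = refl
      ...   | yes x∈xs = ⊥-elim (x∉xs x∈xs)

    count-∈ : (xs : List (Fin n)) → Unique xs → count (_∈? xs) ≡ length xs
    count-∈ []       _              = ∑-zero n
    count-∈ (x ∷ xs) (x∉xs ∷ uxs) = begin
      count (_∈? (x ∷ xs))                                    ≡⟨ sum-cong-≗ (b2n-∈-∷ (All¬⇒¬Any x∉xs)) ⟩
      ∑ (λ i → b2n (does (i Fin.≟ x)) + b2n (does (i ∈? xs))) ≡⟨ ∑-distrib-+ (λ i → b2n (does (i Fin.≟ x))) (λ i → b2n (does (i ∈? xs))) ⟩
      count (Fin._≟ x) + count (_∈? xs)                       ≡⟨ cong₂ _+_ (count-point x) (count-∈ xs uxs) ⟩
      suc (length xs)                                         ∎
      where open ≡-Reasoning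

    module _ {P : Fin n → Set} (P? : Decidable P) where

      private
        b2n-∉ : ∀ {x xs} → x ∉ xs → b2n (does (x ∈? xs)) ≡ 0
        b2n-∉ {x} {xs} x∉ = cong b2n (dec-false (x ∈? xs) x∉)

        b2n-∈-≤ : ∀ {xs} → (∀ {x} → x ∈ xs → P x) → ∀ i → b2n (does (i ∈? xs)) ≤ b2n (does (P? i))
        b2n-∈-≤ {xs} xs⊆P i with i ∈? xs
        ... | no _    = z≤n
        ... | yes i∈ rewrite dec-true (P? i) (xs⊆P i∈) = ≤-refl

      count-ListsExactly : ∀ {xs} → ListsExactly P xs → count P? ≡ length xs
      count-ListsExactly {xs} L = trans (sum-cong-≗ pointwise) (count-∈ xs (unique L))
        where
        pointwise : ∀ i → b2n (does (P? i)) ≡ b2n (does (i ∈? xs))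
        pointwise i = cong b2n (does-⇔ (mk⇔ (complete L) (sound L)) (P? i) (i ∈? xs))

      ListsExactly-filter : ListsExactly P (filter P? (allFin n))
      ListsExactly-filter = record
        { unique   = Unique.filter⁺ P? (Unique.allFin⁺ n)
        ; sound    = λ i∈ → proj₂ (∈-filter⁻ P? {xs = allFin n} i∈)
        ; complete = λ {i} Pi → ∈-filter⁺ P? {xs = allFin n} (∈-allFin i) Pi
        }

      count-list : Σ (List (Fin n)) λ xs → ListsExactly P xs × length xs ≡ count P?
      count-list = _ , ListsExactly-filter , sym (count-ListsExactly ListsExactly-filter)

      length≤count : ∀ {xs} → Unique xs → (∀ {x} → x ∈ xs → P x) → length xs ≤ count P?
      length≤count {xs} u xs⊆P = subst (_≤ count P?) (count-∈ xs u) (∑-mono-≤ (b2n-∈-≤ xs⊆P))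

      complete-by-count : ∀ {xs} → Unique xs → (∀ {x} → x ∈ xs → P x) →
        count P? ≤ length xs → ∀ {x} → P x → x ∈ xs
      complete-by-count {xs} u xs⊆P count≤ {x} Px = decidable-stable (x ∈? xs) λ x∉ →
        <-irrefl refl (<-≤-trans (subst (_< count P?) (count-∈ xs u) (count-∈<count x∉)) count≤)
        where
        count-∈<count : x ∉ xs → count (_∈? xs) < count P?
        count-∈<count x∉ = ∑-mono-< (b2n-∈-≤ xs⊆P) x
          (subst₂ (λ a b → a < b2n b) (sym (b2n-∉ x∉)) (sym (dec-true (P? x) Px)) ≤-refl)

module Digraphs where

  open import Data.Bool using (Bool; true; false)
  import Data.Bool as Bool
  open import Data.Empty using (⊥; ⊥-elim)
  open import Data.Fin using (Fin)
  open import Data.List using (List; []; _∷_; allFin; map; length)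
  open import Data.List.Membership.Propositional using (_∈_)
  open import Data.List.Relation.Unary.Any using (here; there)
  open import Data.List.Relation.Unary.All using ([]; _∷_)
  open import Data.List.Relation.Unary.AllPairs using ([]; _∷_)
  open import Data.List.Relation.Unary.Unique.Propositional using (Unique)
  open import Data.Nat using (ℕ; zero; suc; _+_; _≤_; z≤n; s≤s; _≟_)
  open import Data.Nat.ListAction using (sum)
  open import Data.Product using (Σ; _×_; _,_; proj₁; proj₂)
  open import Data.Sum using (_⊎_; inj₁; inj₂)
  open import Function.Bundles using (Inverse)
  open import Relation.Binary.PropositionalEquality
    using (_≡_; _≢_; refl; sym; trans; cong; subst; module ≡-Reasoning)
  open import Relation.Nullary using (does)

  open import Defs
  open Counting

  Children : ∀ {A : Set} → (A → A → Bool) → A → List A → Set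
  Children E x = ListsExactly (λ y → E x y ≡ true)

  Parents : ∀ {A : Set} → (A → A → Bool) → A → List A → Set
  Parents E y = ListsExactly (λ x → E x y ≡ true)

  Childless : ∀ {A : Set} → (A → A → Bool) → A → Set
  Childless E x = Children E x []

  Childless-Children : ∀ {A : Set} {E : A → A → Bool} {x c cs} → Childless E x → Children E x (c ∷ cs) → ⊥
  Childless-Children noChild ch with complete noChild (sound ch (here refl))
  ... | ()

  Childless-false : ∀ {A : Set} {E : A → A → Bool} {x} → Childless E x → ∀ y → E x y ≡ false
  Childless-false {E = E} {x} noChild y with E x y in e
  ... | false = refl
  ... | true  with complete noChild e
  ...   | ()

  Children-with : ∀ {A : Set} {E : A → A → Bool} {x c₁ c₂ h} → Children E x (c₁ ∷ c₂ ∷ []) → E x h ≡ true →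
    Σ A λ c → Children E x (h ∷ c ∷ [])
  Children-with {c₁ = c₁} {c₂} ch e with ListsExactly-pair ch e
  ... | inj₁ refl = c₂ , ch
  ... | inj₂ refl = c₁ , ListsExactly-swap ch

  module _ {V : ℕ} (G : Digraph V) where

    private
      b2n-does : ∀ b → b2n b ≡ b2n (does (b Bool.≟ true))
      b2n-does true  = refl
      b2n-does false = refl

    indeg-count : ∀ v → indeg G v ≡ count (λ u → G u v Bool.≟ true)
    indeg-count v = trans (sum-map-allFin V _) (sum-cong-≗ (λ u → b2n-does (G u v)))

    outdeg-count : ∀ v → outdeg G v ≡ count (λ w → G v w Bool.≟ true)
    outdeg-count v = trans (sum-map-allFin V _) (sum-cong-≗ (λ w → b2n-does (G v w)))

    outdeg-Children : ∀ {v cs} → Children G v cs → outdeg G v ≡ length cs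
    outdeg-Children {v} ch = trans (outdeg-count v) (count-ListsExactly (λ w → G v w Bool.≟ true) ch)

    indeg-Parents : ∀ {v ps} → Parents G v ps → indeg G v ≡ length ps
    indeg-Parents {v} pa = trans (indeg-count v) (count-ListsExactly (λ u → G u v Bool.≟ true) pa)

    childList : ∀ v → Σ (List (Fin V)) λ cs → Children G v cs × length cs ≡ outdeg G v
    childList v with count-list (λ w → G v w Bool.≟ true)
    ... | cs , ch , len = cs , ch , trans len (sym (outdeg-count v))

    parentList : ∀ v → Σ (List (Fin V)) λ ps → Parents G v ps × length ps ≡ indeg G v
    parentList v with count-list (λ u → G u v Bool.≟ true)
    ... | ps , pa , len = ps , pa , trans len (sym (indeg-count v))

    handshake : ∑ (indeg G) ≡ ∑ (outdeg G)
    handshake = begin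
      ∑ (indeg G)                                  ≡⟨ sum-cong-≗ (λ v → sum-map-allFin V (λ u → b2n (G u v))) ⟩
      ∑ (λ v → ∑ (λ u → b2n (G u v)))             ≡⟨ ∑-comm (λ v u → b2n (G u v)) ⟩
      ∑ (λ u → ∑ (λ v → b2n (G u v)))             ≡⟨ sum-cong-≗ (λ u → sym (sum-map-allFin V (λ v → b2n (G u v)))) ⟩
      ∑ (outdeg G)                                 ∎
      where open ≡-Reasoning

    -- The leaf test of leafCount is a local function in Defs and cannot be named, so it is exposed through this equation.
    private
      leafIndicator : Σ (Fin V → ℕ) λ F → leafCount (V , G) ≡ sum (map F (allFin V))
      leafIndicator = _ , refl

      leafIndicator-≡ : ∀ v → proj₁ leafIndicator v ≡ b2n (does (outdeg G v ≟ 0))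
      leafIndicator-≡ v with outdeg G v
      ... | zero  = refl
      ... | suc _ = refl

    leafCount-count : leafCount (V , G) ≡ count (λ v → outdeg G v ≟ 0)
    leafCount-count = trans (proj₂ leafIndicator)
      (trans (sum-map-allFin V (proj₁ leafIndicator)) (sum-cong-≗ leafIndicator-≡))

    leafCount-ListsExactly : ∀ {ls} → ListsExactly (λ v → outdeg G v ≡ 0) ls → leafCount (V , G) ≡ length ls
    leafCount-ListsExactly L = trans leafCount-count (count-ListsExactly (λ v → outdeg G v ≟ 0) L)

    Children-by-outdeg : ∀ {v cs} → Unique cs → (∀ {w} → w ∈ cs → G v w ≡ true) → outdeg G v ≤ length cs →
      Children G v cs
    Children-by-outdeg {v} u cs⊆ ≤len = record
      { unique = u ; sound = cs⊆
      ; complete = complete-by-count (λ w → G v w Bool.≟ true) u cs⊆ (subst (_≤ _) (outdeg-count v) ≤len) }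

    Parents-by-indeg : ∀ {v ps} → Unique ps → (∀ {u} → u ∈ ps → G u v ≡ true) → indeg G v ≤ length ps →
      Parents G v ps
    Parents-by-indeg {v} u ps⊆ ≤len = record
      { unique = u ; sound = ps⊆
      ; complete = complete-by-count (λ w → G w v Bool.≟ true) u ps⊆ (subst (_≤ _) (indeg-count v) ≤len) }

    two-parents⇒2≤indeg : ∀ {u₁ u₂ v} → u₁ ≢ u₂ → G u₁ v ≡ true → G u₂ v ≡ true → 2 ≤ indeg G v
    two-parents⇒2≤indeg {u₁} {u₂} {v} u₁≢u₂ e₁ e₂ = subst (2 ≤_) (sym (indeg-count v))
      (length≤count (λ u → G u v Bool.≟ true) (Unique-pair u₁≢u₂) λ { (here refl) → e₁ ; (there (here refl)) → e₂ })

    outdeg≡0⇒Childless : ∀ {v} → outdeg G v ≡ 0 → Childless G v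
    outdeg≡0⇒Childless {v} o with childList v
    ... | cs , ch , len with length≡0 {xs = cs} (trans len o)
    ...   | refl = ch

    outdeg≡1⇒Children : ∀ {v} → outdeg G v ≡ 1 → Σ (Fin V) λ c → Children G v (c ∷ [])
    outdeg≡1⇒Children {v} o with childList v
    ... | cs , ch , len with length≡1 {xs = cs} (trans len o)
    ...   | c , refl = c , ch

    outdeg≡2⇒Children : ∀ {v} → outdeg G v ≡ 2 → Σ (Fin V) λ c₁ → Σ (Fin V) λ c₂ → Children G v (c₁ ∷ c₂ ∷ [])
    outdeg≡2⇒Children {v} o with childList v
    ... | cs , ch , len with length≡2 {xs = cs} (trans len o)
    ...   | c₁ , c₂ , refl = c₁ , c₂ , ch

    indeg≡0⇒Parentless : ∀ {v} → indeg G v ≡ 0 → Parents G v []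
    indeg≡0⇒Parentless {v} i with parentList v
    ... | ps , pa , len with length≡0 {xs = ps} (trans len i)
    ...   | refl = pa

    indeg≡2⇒Parents : ∀ {v} → indeg G v ≡ 2 → Σ (Fin V) λ u₁ → Σ (Fin V) λ u₂ → Parents G v (u₁ ∷ u₂ ∷ [])
    indeg≡2⇒Parents {v} i with parentList v
    ... | ps , pa , len with length≡2 {xs = ps} (trans len i)
    ...   | u₁ , u₂ , refl = u₁ , u₂ , pa

    child⇒outdeg≢0 : ∀ {v w} → G v w ≡ true → outdeg G v ≢ 0
    child⇒outdeg≢0 {v} {w} e o≡0 with trans (sym e) (Childless-false {E = G} (outdeg≡0⇒Childless o≡0) w)
    ... | ()

  module _ {V W : ℕ} {G : Digraph V} {H : Digraph W} (iso : Iso (V , G) (W , H)) where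
    open Inverse (proj₁ iso) using (to; from; strictlyInverseˡ; strictlyInverseʳ)

    private
      edges : ∀ u v → G u v ≡ H (to u) (to v)
      edges = proj₂ iso

      to-injective : ∀ {u v} → to u ≡ to v → u ≡ v
      to-injective {u} {v} e = trans (sym (strictlyInverseʳ u)) (trans (cong from e) (strictlyInverseʳ v))

    Children-iso : ∀ {v cs} → Children G v cs → Children H (to v) (map to cs)
    Children-iso {v} = ListsExactly-map to to-injective
      (λ {u} e → trans (sym (edges v u)) e) (λ {u} e → trans (edges v u) e) (λ {w} _ → from w , sym (strictlyInverseˡ w))

    indeg-iso : ∀ v → indeg H (to v) ≡ indeg G v
    indeg-iso v = begin
      indeg H (to v)                      ≡⟨ sum-map-allFin W (λ w → b2n (H w (to v))) ⟩
      ∑ (λ w → b2n (H w (to v)))          ≡⟨ ∑-permute (λ w → b2n (H w (to v))) (proj₁ iso) ⟩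
      ∑ (λ u → b2n (H (to u) (to v)))     ≡⟨ sum-cong-≗ (λ u → cong b2n (sym (edges u v))) ⟩
      ∑ (λ u → b2n (G u v))               ≡⟨ sum-map-allFin V (λ u → b2n (G u v)) ⟨
      indeg G v                           ∎
      where open ≡-Reasoning

    outdeg-iso : ∀ v → outdeg H (to v) ≡ outdeg G v
    outdeg-iso v = begin
      outdeg H (to v)                     ≡⟨ sum-map-allFin W (λ w → b2n (H (to v) w)) ⟩
      ∑ (λ w → b2n (H (to v) w))          ≡⟨ ∑-permute (λ w → b2n (H (to v) w)) (proj₁ iso) ⟩
      ∑ (λ u → b2n (H (to v) (to u)))     ≡⟨ sum-cong-≗ (λ u → cong b2n (sym (edges v u))) ⟩
      ∑ (λ u → b2n (G v u))               ≡⟨ sum-map-allFin V (λ u → b2n (G v u)) ⟨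
      outdeg G v                          ∎
      where open ≡-Reasoning

    leafCount-iso : leafCount (W , H) ≡ leafCount (V , G)
    leafCount-iso = begin
      leafCount (W , H)                           ≡⟨ leafCount-count H ⟩
      count (λ w → outdeg H w ≟ 0)                ≡⟨ ∑-permute (λ w → b2n (does (outdeg H w ≟ 0))) (proj₁ iso) ⟩
      ∑ (λ u → b2n (does (outdeg H (to u) ≟ 0)))  ≡⟨ sum-cong-≗ (λ u → cong (λ k → b2n (does (k ≟ 0))) (outdeg-iso u)) ⟩
      count (λ u → outdeg G u ≟ 0)                ≡⟨ leafCount-count G ⟨
      leafCount (V , G)                           ∎
      where open ≡-Reasoning

  AllowedDegrees : ℕ → ℕ → Set
  AllowedDegrees i o = (i ≡ 0 × o ≡ 2) ⊎ (i ≡ 1 × o ≡ 2) ⊎ (i ≡ 1 × o ≡ 0) ⊎ (i ≡ 2 × o ≡ 1)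

  module _ {i o : ℕ} where

    AllowedDegrees-indeg≤2 : AllowedDegrees i o → i ≤ 2
    AllowedDegrees-indeg≤2 (inj₁ (refl , _))                = z≤n
    AllowedDegrees-indeg≤2 (inj₂ (inj₁ (refl , _)))         = s≤s z≤n
    AllowedDegrees-indeg≤2 (inj₂ (inj₂ (inj₁ (refl , _))))  = s≤s z≤n
    AllowedDegrees-indeg≤2 (inj₂ (inj₂ (inj₂ (refl , _))))  = s≤s (s≤s z≤n)

    AllowedDegrees-indeg≤1 : AllowedDegrees i o → o ≢ 1 → i ≤ 1
    AllowedDegrees-indeg≤1 (inj₁ (refl , _))                 _   = z≤n
    AllowedDegrees-indeg≤1 (inj₂ (inj₁ (refl , _)))          _   = s≤s z≤n
    AllowedDegrees-indeg≤1 (inj₂ (inj₂ (inj₁ (refl , _))))   _   = s≤s z≤n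
    AllowedDegrees-indeg≤1 (inj₂ (inj₂ (inj₂ (_ , o≡1))))    o≢1 = ⊥-elim (o≢1 o≡1)

    AllowedDegrees-outdeg≡2 : AllowedDegrees i o → o ≢ 0 → i ≢ 2 → o ≡ 2
    AllowedDegrees-outdeg≡2 (inj₁ (_ , o≡2))                _   _   = o≡2
    AllowedDegrees-outdeg≡2 (inj₂ (inj₁ (_ , o≡2)))         _   _   = o≡2
    AllowedDegrees-outdeg≡2 (inj₂ (inj₂ (inj₁ (_ , o≡0))))  o≢0 _   = ⊥-elim (o≢0 o≡0)
    AllowedDegrees-outdeg≡2 (inj₂ (inj₂ (inj₂ (i≡2 , _))))  _   i≢2 = ⊥-elim (i≢2 i≡2)

    AllowedDegrees-hybrid : AllowedDegrees i o → i ≡ 2 → o ≡ 1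
    AllowedDegrees-hybrid (inj₁ (refl , _))               ()
    AllowedDegrees-hybrid (inj₂ (inj₁ (refl , _)))        ()
    AllowedDegrees-hybrid (inj₂ (inj₂ (inj₁ (refl , _)))) ()
    AllowedDegrees-hybrid (inj₂ (inj₂ (inj₂ (_ , o≡1))))  _ = o≡1

    AllowedDegrees-root : AllowedDegrees i o → i ≡ 0 → o ≡ 2
    AllowedDegrees-root (inj₁ (_ , o≡2))                _ = o≡2
    AllowedDegrees-root (inj₂ (inj₁ (refl , _)))        ()
    AllowedDegrees-root (inj₂ (inj₂ (inj₁ (refl , _)))) ()
    AllowedDegrees-root (inj₂ (inj₂ (inj₂ (refl , _)))) ()

    -- Summed over all vertices, with the handshake lemma: #(out-degree 2) + 1 = #leaves + #reticulations.
    AllowedDegrees-balance : AllowedDegrees i o →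
      o + b2n (does (o ≟ 0)) + b2n (does (i ≟ 2)) ≡ i + b2n (does (o ≟ 2)) + b2n (does (i ≟ 0))
    AllowedDegrees-balance (inj₁ (refl , refl))               = refl
    AllowedDegrees-balance (inj₂ (inj₁ (refl , refl)))        = refl
    AllowedDegrees-balance (inj₂ (inj₂ (inj₁ (refl , refl)))) = refl
    AllowedDegrees-balance (inj₂ (inj₂ (inj₂ (refl , refl)))) = refl

    AllowedDegrees-outdeg≢1 : AllowedDegrees i o → i ≢ 2 → o ≢ 1
    AllowedDegrees-outdeg≢1 (inj₁ (_ , refl))               _   ()
    AllowedDegrees-outdeg≢1 (inj₂ (inj₁ (_ , refl)))        _   ()
    AllowedDegrees-outdeg≢1 (inj₂ (inj₂ (inj₁ (_ , refl)))) _   ()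
    AllowedDegrees-outdeg≢1 (inj₂ (inj₂ (inj₂ (i≡2 , _))))  i≢2 = ⊥-elim (i≢2 i≡2)

    AllowedDegrees-indeg≡1 : AllowedDegrees i o → i ≢ 0 → i ≢ 2 → i ≡ 1
    AllowedDegrees-indeg≡1 (inj₁ (i≡0 , _))                i≢0 _   = ⊥-elim (i≢0 i≡0)
    AllowedDegrees-indeg≡1 (inj₂ (inj₁ (i≡1 , _)))         _   _   = i≡1
    AllowedDegrees-indeg≡1 (inj₂ (inj₂ (inj₁ (i≡1 , _))))  _   _   = i≡1
    AllowedDegrees-indeg≡1 (inj₂ (inj₂ (inj₂ (i≡2 , _))))  _   i≢2 = ⊥-elim (i≢2 i≡2)

module Chains where

  open import Data.Bool using (true)
  open import Data.Empty using (⊥-elim)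
  open import Data.Fin using (Fin; zero)
  open import Data.List using (List; []; _∷_; _++_; [_]; length)
  open import Data.List.Properties using (length-++)
  open import Data.List.Membership.Propositional using (_∈_; _∉_)
  open import Data.List.Relation.Unary.All.Properties using (¬Any⇒All¬)
  open import Data.List.Relation.Unary.All using ([]; _∷_)
  open import Data.List.Relation.Unary.Any using (here; there)
  open import Data.List.Relation.Unary.AllPairs using ([]; _∷_)
  open import Data.List.Relation.Unary.Unique.Propositional using (Unique)
  open import Data.Nat using (ℕ; zero; suc; _+_; _≤_; _<_; z≤n; s≤s; _≟_)
  open import Data.Nat.Properties using (≤-trans; ≤-pred; n≤1+n; +-comm; *-identityʳ; <⇒≱)
  open import Data.Product using (Σ; _×_; _,_)
  open import Data.Sum using (_⊎_; inj₁; inj₂)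
  open import Data.Unit using (tt)
  open import Relation.Binary.PropositionalEquality using (_≡_; _≢_; refl; sym; trans; cong; subst)
  open import Relation.Nullary using (yes; no)

  open import Defs
  open Counting
  open Digraphs

  module _ {V : ℕ} {G : Digraph V} where

    chain-snoc : ∀ {s xs t u} → Chain G s xs t → G t u ≡ true → Chain G s (xs ++ [ t ]) u
    chain-snoc (direct e) e′ = step e (direct e′)
    chain-snoc (step e c) e′ = step e (chain-snoc c e′)

    chain-first : ∀ {s xs t} → Chain G s xs t → Σ (Fin V) λ y → G s y ≡ true
    chain-first {t = t} (direct e)     = t , e
    chain-first (step {x = x} e _) = x , e

    chain-prefix : ∀ {s xs t y} → Chain G s xs t → y ∈ xs → Σ (List (Fin V)) λ ys → Chain G s ys y
    chain-prefix (step e c) (here refl) = [] , direct e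
    chain-prefix (step {x = x} e c) (there y∈) with chain-prefix c y∈
    ... | ys , c′ = x ∷ ys , step e c′

    chain-suffix : ∀ {s xs t y} → Chain G s xs t → y ∈ xs → Σ (List (Fin V)) λ ys → Chain G y ys t
    chain-suffix (step e c) (here refl) = _ , c
    chain-suffix (step e c) (there y∈)  = chain-suffix c y∈

    chain-last : ∀ {s xs t} → Chain G s xs t →
      (xs ≡ [] × G s t ≡ true) ⊎
      Σ (List (Fin V)) λ ys → Σ (Fin V) λ y → xs ≡ ys ++ [ y ] × Chain G s ys y × G y t ≡ true
    chain-last (direct e) = inj₁ (refl , e)
    chain-last (step {x = x} e c) with chain-last c
    ... | inj₁ (refl , e′)                = inj₂ ([] , x , refl , direct e , e′)
    ... | inj₂ (ys , y , refl , c′ , e′) = inj₂ (x ∷ ys , y , refl , step e c′ , e′)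

    module _ (acyclic : Acyclic G) where

      chain-source≢target : ∀ {s xs t} → Chain G s xs t → s ≢ t
      chain-source≢target {s} {xs} c refl = acyclic s xs c

      source∉chain : ∀ {s xs t} → Chain G s xs t → s ∉ xs
      source∉chain {s} c s∈ with chain-prefix c s∈
      ... | ys , c′ = acyclic s ys c′

      target∉chain : ∀ {s xs t} → Chain G s xs t → t ∉ xs
      target∉chain {t = t} c t∈ with chain-suffix c t∈
      ... | ys , c′ = acyclic t ys c′

      chain-Unique : ∀ {s xs t} → Chain G s xs t → Unique (s ∷ xs)
      chain-Unique (direct e)  = [] ∷ []
      chain-Unique (step e c) = ¬Any⇒All¬ _ (source∉chain (step e c)) ∷ chain-Unique c

      chain-length : ∀ {s xs t} → Chain G s xs t → suc (length xs) ≤ V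
      chain-length {s} {xs} c = subst (suc (length xs) ≤_) (trans (∑-const V 1) (*-identityʳ V))
        (length≤count (λ _ → yes tt) (chain-Unique c) (λ _ → tt))

    Reachable : Fin V → Fin V → Set
    Reachable r v = v ≡ r ⊎ Σ (List (Fin V)) λ xs → Chain G r xs v

    reachable-step : ∀ {r u v} → Reachable r u → G u v ≡ true → Reachable r v
    reachable-step (inj₁ refl)      e = inj₂ ([] , direct e)
    reachable-step (inj₂ (xs , c)) e = inj₂ (_ , chain-snoc c e)

    some-parent : ∀ v → indeg G v ≢ 0 → Σ (Fin V) λ u → G u v ≡ true
    some-parent v indeg≢0 with parentList G v
    ... | []    , _  , len = ⊥-elim (indeg≢0 (sym len))
    ... | u ∷ _ , pa , _   = u , sound pa (here refl)

    module _ (acyclic : Acyclic G) (r : Fin V) (only-root : ∀ v → indeg G v ≡ 0 → v ≡ r) where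

      private
        ancestry : ∀ k v → Reachable r v ⊎ Σ (Fin V) λ u → Σ (List (Fin V)) λ xs → Chain G u xs v × k ≤ length xs
        ancestry k v with indeg G v ≟ 0
        ... | yes indeg≡0 = inj₁ (inj₁ (only-root v indeg≡0))
        ... | no indeg≢0 with some-parent v indeg≢0
        ancestry zero    v | no _ | u , e = inj₂ (u , [] , direct e , z≤n)
        ancestry (suc k) v | no _ | u , e with ancestry k u
        ... | inj₁ r⇝u = inj₁ (reachable-step r⇝u e)
        ... | inj₂ (w , xs , c , k≤) =
          inj₂ (w , xs ++ [ u ] , chain-snoc c e , subst (suc k ≤_) (sym (trans (length-++ xs) (+-comm (length xs) 1))) (s≤s k≤))

      reachable-from-root : ∀ v → Reachable r v
      reachable-from-root v with ancestry V v
      ... | inj₁ r⇝v = r⇝v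
      ... | inj₂ (_ , xs , c , V≤) = ⊥-elim (<⇒≱ (chain-length acyclic c) V≤)

    Height : Fin V → ℕ → Set
    Height x k = ∀ {xs y} → Chain G x xs y → length xs < k

    Height-child : ∀ {x y k} → Height x (suc k) → G x y ≡ true → Height y k
    Height-child h e c = ≤-pred (h (step e c))

    Height-grandchild : ∀ {x y z k} → Height x (suc k) → G x y ≡ true → G y z ≡ true → Height z k
    Height-grandchild h e e′ c = ≤-pred (≤-trans (n≤1+n _) (h (step e (step e′ c))))

    Height-bounded : Acyclic G → ∀ x → Height x V
    Height-bounded acyclic x c = chain-length acyclic c

  single-vertex-outdeg : ∀ {G : Digraph 1} → NoLoops G → ∀ v → outdeg G v ≡ 0
  single-vertex-outdeg noLoops zero = cong (λ b → b2n b + 0) (noLoops zero)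

  single-vertex-indeg : ∀ {G : Digraph 1} → NoLoops G → ∀ v → indeg G v ≡ 0
  single-vertex-indeg noLoops zero = cong (λ b → b2n b + 0) (noLoops zero)

  network-root : ∀ {V} {G : Digraph V} → IsNetwork (V , G) →
    Σ (Fin V) λ r → indeg G r ≡ 0 × (∀ v → indeg G v ≡ 0 → v ≡ r)
  network-root {G = G} (noLoops , _ , inj₁ refl) = zero , single-vertex-indeg {G = G} noLoops zero , λ { zero _ → refl }
  network-root (_ , _ , inj₂ (_ , (r , r-parentless) , unique-root)) = r , r-parentless , λ v v0 → unique-root v r v0 r-parentless

module Shapes where

  open import Data.Empty using (⊥; ⊥-elim)
  open import Data.Fin using (Fin; zero; suc)
  open import Data.List using (List; []; _∷_; [_]; length; lookup; filter; deduplicate; cartesianProductWith)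
  open import Data.List.Membership.Propositional using (_∈_)
  open import Data.List.Membership.Propositional.Properties
    using (∈-filter⁺; ∈-filter⁻; ∈-cartesianProductWith⁺; ∈-deduplicate⁻; ∈-lookup)
  import Data.List.Relation.Unary.All as All
  open import Data.List.Relation.Unary.All.Properties using (all-filter)
  open import Data.List.Relation.Unary.AllPairs using (AllPairs; []; _∷_)
  import Data.List.Relation.Unary.AllPairs.Properties as AllPairs
  open import Data.List.Relation.Unary.Any as Any using (Any; here; there; index)
  open import Data.List.Relation.Unary.Any.Properties using (lookup-index; deduplicate⁺)
  open import Data.Nat using (ℕ; zero; suc; _+_; _≤_; _⊔_; z≤n; s≤s; _≟_)
  open import Data.Nat.Properties using (≤-trans; m≤m+n; m≤n+m; m≤m⊔n; m≤n⊔m; ⊔-lub; +-suc; suc-injective)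
  open import Data.Product using (Σ; _×_; _,_; proj₂)
  open import Data.Sum using (_⊎_; inj₁; inj₂)
  open import Data.Unit using (⊤; tt)
  open import Data.Vec using (Vec; tabulate) renaming (lookup to vlookup)
  open import Data.Vec.Properties using (lookup∘tabulate)
  open import Relation.Binary.PropositionalEquality using (_≡_; _≢_; refl; sym; trans; cong; subst)
  open import Relation.Nullary using (Dec; yes; no; ¬_; _×-dec_; _⊎-dec_; ¬?)

  open import Defs

  data Shape : Set where
    leaf : Shape
    node : Shape → Shape → Shape

  leaves : Shape → ℕ
  leaves leaf       = 1
  leaves (node a b) = leaves a + leaves b

  internal : Shape → ℕ
  internal leaf       = 0
  internal (node a b) = suc (internal a + internal b)

  leaves≡1+internal : ∀ s → leaves s ≡ suc (internal s)
  leaves≡1+internal leaf       = refl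
  leaves≡1+internal (node a b) rewrite leaves≡1+internal a | leaves≡1+internal b =
    cong suc (+-suc (internal a) (internal b))

  infix 4 _≅_ _≅?_

  -- Shapes are plane trees; ≅ identifies them up to swapping the two subtrees of any node.
  _≅_ : Shape → Shape → Set
  leaf     ≅ leaf     = ⊤
  node a b ≅ node c d = (a ≅ c × b ≅ d) ⊎ (a ≅ d × b ≅ c)
  _        ≅ _        = ⊥

  ≅-refl : ∀ s → s ≅ s
  ≅-refl leaf       = tt
  ≅-refl (node a b) = inj₁ (≅-refl a , ≅-refl b)

  ≅-sym : ∀ {s t} → s ≅ t → t ≅ s
  ≅-sym {leaf}     {leaf}     _                 = tt
  ≅-sym {node _ _} {node _ _} (inj₁ (p , q)) = inj₁ (≅-sym p , ≅-sym q)
  ≅-sym {node _ _} {node _ _} (inj₂ (p , q)) = inj₂ (≅-sym q , ≅-sym p)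

  ≅-trans : ∀ {s t u} → s ≅ t → t ≅ u → s ≅ u
  ≅-trans {leaf}     {leaf}     {leaf}     _ _ = tt
  ≅-trans {node _ _} {node _ _} {node _ _} (inj₁ (p , q)) (inj₁ (p′ , q′)) = inj₁ (≅-trans p p′ , ≅-trans q q′)
  ≅-trans {node _ _} {node _ _} {node _ _} (inj₁ (p , q)) (inj₂ (p′ , q′)) = inj₂ (≅-trans p p′ , ≅-trans q q′)
  ≅-trans {node _ _} {node _ _} {node _ _} (inj₂ (p , q)) (inj₁ (p′ , q′)) = inj₂ (≅-trans p q′ , ≅-trans q p′)
  ≅-trans {node _ _} {node _ _} {node _ _} (inj₂ (p , q)) (inj₂ (p′ , q′)) = inj₁ (≅-trans p q′ , ≅-trans q p′)

  _≅?_ : ∀ s t → Dec (s ≅ t)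
  leaf     ≅? leaf     = yes tt
  leaf     ≅? node _ _ = no λ ()
  node _ _ ≅? leaf     = no λ ()
  node a b ≅? node c d = ((a ≅? c) ×-dec (b ≅? d)) ⊎-dec ((a ≅? d) ×-dec (b ≅? c))

  depth : Shape → ℕ
  depth leaf       = 0
  depth (node a b) = suc (depth a ⊔ depth b)

  depth≤internal : ∀ s → depth s ≤ internal s
  depth≤internal leaf       = z≤n
  depth≤internal (node a b) =
    s≤s (⊔-lub (≤-trans (depth≤internal a) (m≤m+n _ _)) (≤-trans (depth≤internal b) (m≤n+m _ _)))

  shapesOfDepth≤ : ℕ → List Shape
  shapesOfDepth≤ zero    = [ leaf ]
  shapesOfDepth≤ (suc k) = leaf ∷ cartesianProductWith node (shapesOfDepth≤ k) (shapesOfDepth≤ k)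

  ∈-shapesOfDepth≤ : ∀ s {k} → depth s ≤ k → s ∈ shapesOfDepth≤ k
  ∈-shapesOfDepth≤ leaf       {zero}  _        = here refl
  ∈-shapesOfDepth≤ leaf       {suc k} _        = here refl
  ∈-shapesOfDepth≤ (node a b) {suc k} (s≤s d≤) = there (∈-cartesianProductWith⁺ node
    (∈-shapesOfDepth≤ a (≤-trans (m≤m⊔n _ _) d≤)) (∈-shapesOfDepth≤ b (≤-trans (m≤n⊔m _ _) d≤)))

  shapeClasses : ℕ → List Shape
  shapeClasses m = deduplicate _≅?_ (filter (λ s → leaves s ≟ suc m) (shapesOfDepth≤ m))

  shapeClasses-leaves : ∀ {m s} → s ∈ shapeClasses m → leaves s ≡ suc m
  shapeClasses-leaves {m} s∈ =
    proj₂ (∈-filter⁻ (λ s → leaves s ≟ suc m) {xs = shapesOfDepth≤ m} (∈-deduplicate⁻ _≅?_ _ s∈))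

  shapeClasses-complete : ∀ {m} s → leaves s ≡ suc m → Any (s ≅_) (shapeClasses m)
  shapeClasses-complete {m} s s-leaves = deduplicate⁺ _≅?_ (λ u≅t s≅t → ≅-trans s≅t (≅-sym u≅t))
    (Any.map (λ { refl → ≅-refl s }) (∈-filter⁺ (λ s → leaves s ≟ suc m) (∈-shapesOfDepth≤ s depth≤m) s-leaves))
    where
    depth≤m : depth s ≤ m
    depth≤m = subst (depth s ≤_) (suc-injective (trans (sym (leaves≡1+internal s)) s-leaves)) (depth≤internal s)

  deduplicate-distinct : ∀ xs → AllPairs (λ s t → ¬ s ≅ t) (deduplicate _≅?_ xs)
  deduplicate-distinct []       = []
  deduplicate-distinct (x ∷ xs) =
    all-filter (λ y → ¬? (x ≅? y)) (deduplicate _≅?_ xs) ∷ AllPairs.filter⁺ (λ y → ¬? (x ≅? y)) (deduplicate-distinct xs)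

  shapeClasses-distinct : ∀ m → AllPairs (λ s t → ¬ s ≅ t) (shapeClasses m)
  shapeClasses-distinct m = deduplicate-distinct (filter (λ s → leaves s ≟ suc m) (shapesOfDepth≤ m))

  AllPairs-lookup : ∀ {A : Set} {R : A → A → Set} → (∀ {x y} → R x y → R y x) →
    ∀ {xs} → AllPairs R xs → ∀ {i j} → i ≢ j → R (lookup xs i) (lookup xs j)
  AllPairs-lookup sym-R (Rx ∷ _)   {zero}  {zero}  0≢0 = ⊥-elim (0≢0 refl)
  AllPairs-lookup sym-R (Rx ∷ _)   {zero}  {suc j} _   = All.lookup Rx (∈-lookup j)
  AllPairs-lookup sym-R (Rx ∷ _)   {suc i} {zero}  _   = sym-R (All.lookup Rx (∈-lookup i))
  AllPairs-lookup sym-R (_ ∷ Rxs) {suc i} {suc j} i≢j = AllPairs-lookup sym-R Rxs (λ i≡j → i≢j (cong suc i≡j))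

  classCount : (P : Graph → Set) (graphOf : Shape → Graph) (L : List Shape) →
    AllPairs (λ s t → ¬ s ≅ t) L →
    (∀ {s} → s ∈ L → P (graphOf s)) →
    (∀ {s t} → Iso (graphOf s) (graphOf t) → s ≅ t) →
    (∀ H → P H → Any (λ s → Iso H (graphOf s)) L) →
    ClassCount P (length L)
  classCount P graphOf L distinct sound iso⇒≅ complete = reps , reps-P , reps-distinct , reps-complete
    where
    reps : Vec Graph (length L)
    reps = tabulate (λ i → graphOf (lookup L i))
    reps-≡ : ∀ i → vlookup reps i ≡ graphOf (lookup L i)
    reps-≡ = lookup∘tabulate (λ i → graphOf (lookup L i))
    reps-P : ∀ i → P (vlookup reps i)
    reps-P i = subst P (sym (reps-≡ i)) (sound (∈-lookup i))
    reps-distinct : ∀ i j → i ≢ j → ¬ Iso (vlookup reps i) (vlookup reps j)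
    reps-distinct i j i≢j rewrite reps-≡ i | reps-≡ j =
      λ iso → AllPairs-lookup (λ ¬s≅t t≅s → ¬s≅t (≅-sym t≅s)) distinct i≢j (iso⇒≅ iso)
    reps-complete : ∀ H → P H → Σ (Fin (length L)) λ i → Iso H (vlookup reps i)
    reps-complete H PH = index H≅ , subst (Iso H) (sym (reps-≡ (index H≅))) (lookup-index H≅)
      where H≅ = complete H PH

module PositionGraphs where

  open import Data.Bool using (Bool; true; false)
  open import Data.Empty using (⊥-elim)
  open import Data.Fin using (Fin)
  open import Data.List using (List; []; _∷_; map; length)
  open import Data.List.Properties using (length-map)
  open import Data.List.Membership.Propositional using (_∈_)
  open import Data.List.Membership.Propositional.Properties using (∈-map⁺; ∈-map⁻)
  open import Data.List.Relation.Unary.Any using (here)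
  open import Data.List.Relation.Unary.Unique.Propositional using (Unique)
  open import Data.Nat using (ℕ; suc; _+_; _<_; _≤_; s≤s)
  open import Data.Fin.Properties using (+↔⊎)
  open import Data.Sum.Function.Propositional using (_⊎-↔_)
  open import Function.Properties.Inverse using (↔-refl; ↔-sym; ↔-trans)
  open import Data.Nat.Properties using (<-irrefl; ≤-refl; ≤-reflexive; ≤-trans; n≤1+n; <-≤-trans)
  open import Data.Product using (Σ; _×_; _,_; proj₁; proj₂)
  open import Data.Sum using (_⊎_; inj₁; inj₂)
  open import Function.Bundles using (_↔_; Inverse; mk↔ₛ′)
  open import Relation.Binary.PropositionalEquality using (_≡_; _≢_; refl; sym; trans; cong; cong₂; subst; subst₂; module ≡-Reasoning)

  open import Defs
  open Counting
  open Digraphs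
  open Chains

  node-enum : ∀ {k m n} {A B C : Set} → C ↔ (Fin k ⊎ (A ⊎ B)) → A ↔ Fin m → B ↔ Fin n → C ↔ Fin (k + (m + n))
  node-enum split enumA enumB =
    ↔-trans split (↔-trans (↔-refl ⊎-↔ (enumA ⊎-↔ enumB)) (↔-sym (↔-trans +↔⊎ (↔-refl ⊎-↔ +↔⊎))))

  -- The level grows by one along every edge, which makes these graphs acyclic.
  record Positions : Set₁ where
    field
      Pos           : Set
      size          : ℕ
      enum          : Pos ↔ Fin size
      edge          : Pos → Pos → Bool
      children      : Pos → List Pos
      parents       : Pos → List Pos
      children-spec : ∀ p → Children edge p (children p)
      parents-spec  : ∀ p → Parents edge p (parents p)
      root          : Pos
      parents-root  : parents root ≡ []
      rooted        : ∀ p → parents p ≡ [] → p ≡ root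
      level         : Pos → ℕ
      level-edge    : ∀ {p q} → edge p q ≡ true → level q ≡ suc (level p)

  module PositionGraph (P : Positions) where
    open Positions P public

    index : Pos → Fin size
    index = Inverse.to enum

    position : Fin size → Pos
    position = Inverse.from enum

    position-index : ∀ p → position (index p) ≡ p
    position-index = Inverse.strictlyInverseʳ enum

    index-position : ∀ i → index (position i) ≡ i
    index-position = Inverse.strictlyInverseˡ enum

    index-injective : ∀ {p q} → index p ≡ index q → p ≡ q
    index-injective {p} {q} e = trans (sym (position-index p)) (trans (cong position e) (position-index q))

    graph : Digraph size
    graph i j = edge (position i) (position j)

    asGraph : Graph
    asGraph = size , graph

    graph-index : ∀ p q → graph (index p) (index q) ≡ edge p q
    graph-index p q = cong₂ edge (position-index p) (position-index q)

    root-or-parent : ∀ p → p ≡ root ⊎ Σ Pos λ p′ → p′ ∈ parents p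
    root-or-parent p with parents p | rooted p
    ... | []     | root! = inj₁ (root! refl)
    ... | p′ ∷ _ | _     = inj₂ (p′ , here refl)

    private
      index-image : ∀ {v} → Σ Pos λ p → v ≡ index p
      index-image {v} = position v , sym (index-position v)

    Children-index : ∀ {p cs} → Children edge p cs → Children graph (index p) (map index cs)
    Children-index {p} = ListsExactly-map index index-injective
      (λ {q} e → trans (graph-index p q) e) (λ {q} e → trans (sym (graph-index p q)) e) (λ _ → index-image)

    Children-graph : ∀ p → Children graph (index p) (map index (children p))
    Children-graph p = Children-index (children-spec p)

    Parents-graph : ∀ p → Parents graph (index p) (map index (parents p))
    Parents-graph p = ListsExactly-map index index-injective
      (λ {q} e → trans (graph-index q p) e) (λ {q} e → trans (sym (graph-index q p)) e) (λ _ → index-image)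
      (parents-spec p)

    outdeg-graph : ∀ p → outdeg graph (index p) ≡ length (children p)
    outdeg-graph p = trans (outdeg-Children graph (Children-graph p)) (length-map index (children p))

    indeg-graph : ∀ p → indeg graph (index p) ≡ length (parents p)
    indeg-graph p = trans (indeg-Parents graph (Parents-graph p)) (length-map index (parents p))

    indeg-graph-position : ∀ v → indeg graph v ≡ length (parents (position v))
    indeg-graph-position v = trans (cong (indeg graph) (sym (index-position v))) (indeg-graph (position v))

    private
      chain-level : ∀ {u xs v} → Chain graph u xs v → level (position u) < level (position v)
      chain-level (direct e) = ≤-reflexive (sym (level-edge e))
      chain-level (step e c) = <-≤-trans (≤-reflexive (sym (level-edge e))) (≤-trans (n≤1+n _) (chain-level c))

    acyclic : Acyclic graph
    acyclic v xs c = <-irrefl refl (chain-level c)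

    noLoops : NoLoops graph
    noLoops v with graph v v in e
    ... | false = refl
    ... | true  = ⊥-elim (<-irrefl refl (chain-level (direct e)))

    leafCount-graph : ∀ {ls} → ListsExactly (λ p → children p ≡ []) ls → leafCount asGraph ≡ length ls
    leafCount-graph {ls} L = trans (leafCount-ListsExactly graph (ListsExactly-map index index-injective
        (λ {p} cs≡[] → trans (outdeg-graph p) (cong length cs≡[]))
        (λ {p} o≡0 → length≡0 (trans (sym (outdeg-graph p)) o≡0)) (λ _ → index-image) L))
      (length-map index ls)

    indeg-root : indeg graph (index root) ≡ 0
    indeg-root = trans (indeg-graph root) (cong length parents-root)

    parentless-root : ∀ v → indeg graph v ≡ 0 → v ≡ index root
    parentless-root v indeg≡0 = trans (sym (index-position v)) (cong index (rooted (position v) (length≡0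
      (trans (sym (indeg-graph (position v))) (subst (λ w → indeg graph w ≡ 0) (sym (index-position v)) indeg≡0)))))

    isNetwork : size ≡ 1 ⊎ (∀ p → AllowedDegrees (length (parents p)) (length (children p))) → IsNetwork asGraph
    isNetwork (inj₁ size≡1)  = noLoops , acyclic , inj₁ size≡1
    isNetwork (inj₂ allowed) = noLoops , acyclic , inj₂ (allowed-graph , (index root , indeg-root) , unique-root)
      where
      allowed-graph : ∀ v → AllowedType graph v
      allowed-graph v = subst (AllowedType graph) (index-position v)
        (subst₂ AllowedDegrees (sym (indeg-graph (position v))) (sym (outdeg-graph (position v))) (allowed (position v)))
      unique-root : ∀ u v → indeg graph u ≡ 0 → indeg graph v ≡ 0 → u ≡ v
      unique-root u v u0 v0 = trans (parentless-root u u0) (sym (parentless-root v v0))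

    module _ {V : ℕ} (G : Digraph V) (emb : Pos → Fin V)
      (emb-children : ∀ p → Children G (emb p) (map emb (children p))) where

      parent-edge : ∀ {p q} → q ∈ parents p → G (emb q) (emb p) ≡ true
      parent-edge {p} {q} q∈ = sound (emb-children q) (∈-map⁺ emb (complete (children-spec q) (sound (parents-spec p) q∈)))

      Parents-embedding : ∀ p → Unique (map emb (parents p)) → indeg G (emb p) ≤ length (parents p) →
        Parents G (emb p) (map emb (parents p))
      Parents-embedding p u indeg≤ = Parents-by-indeg G u (λ u∈ → edge-of (∈-map⁻ emb u∈))
        (subst (indeg G (emb p) ≤_) (sym (length-map emb (parents p))) indeg≤)
        where
        edge-of : ∀ {u} → Σ Pos (λ q → q ∈ parents p × u ≡ emb q) → G u (emb p) ≡ true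
        edge-of (q , q∈ , refl) = parent-edge q∈

    module Embedding {V : ℕ} (G : Digraph V) (emb : Pos → Fin V)
      (emb-children : ∀ p → Children G (emb p) (map emb (children p)))
      (emb-parents  : ∀ p → Parents G (emb p) (map emb (parents p)))
      (reachable    : ∀ v → Reachable {G = G} (emb root) v) where

      private
        edge-to : ∀ {p p′} → p′ ∈ parents p → G (emb p′) (emb p) ≡ true
        edge-to = parent-edge G emb emb-children

        root-parentless : ∀ {p u} → emb p ≡ emb root → G u (emb p) ≢ true
        root-parentless {p} {u} e g with complete (emb-parents root) (subst (λ w → G u w ≡ true) e g)
        ... | u∈ rewrite parents-root with u∈
        ... | ()

        injective-below : ∀ k {p q} → level p < k → emb p ≡ emb q → p ≡ q
        injective-below k {p} {q} lt e with root-or-parent p | root-or-parent q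
        ... | inj₁ refl | inj₁ refl = refl
        ... | inj₁ refl | inj₂ (_ , q′∈) = ⊥-elim (root-parentless (sym e) (edge-to q′∈))
        ... | inj₂ (_ , p′∈) | inj₁ refl = ⊥-elim (root-parentless e (edge-to p′∈))
        injective-below (suc k) {p} {q} (s≤s lt) e | inj₂ (p′ , p′∈) | inj₂ _
          with ∈-map⁻ emb (complete (emb-parents q) (subst (λ w → G (emb p′) w ≡ true) e (edge-to p′∈)))
        ... | q′ , q′∈ , e′ with injective-below k (≤-trans (≤-reflexive (sym (level-edge p′→p))) lt) e′
          where p′→p = sound (parents-spec p) p′∈
        ... | refl = Unique-map-injective (unique (emb-children p′))
          (complete (children-spec p′) (sound (parents-spec p) p′∈))
          (complete (children-spec p′) (sound (parents-spec q) q′∈)) e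

      emb-injective : ∀ {p q} → emb p ≡ emb q → p ≡ q
      emb-injective = injective-below _ ≤-refl

      private
        child-image : ∀ p {w} → G (emb p) w ≡ true → Σ Pos λ q → emb q ≡ w
        child-image p e with ∈-map⁻ emb (complete (emb-children p) e)
        ... | q , _ , refl = q , refl

        image-along : ∀ p {xs w} → Chain G (emb p) xs w → Σ Pos λ q → emb q ≡ w
        image-along p (direct e) = child-image p e
        image-along p (step e c) with child-image p e
        ... | q , refl = image-along q c

      emb-surjective : ∀ v → Σ Pos λ p → emb p ≡ v
      emb-surjective v with reachable v
      ... | inj₁ refl     = root , refl
      ... | inj₂ (_ , c) = image-along root c

      emb-edge : ∀ p q → G (emb p) (emb q) ≡ edge p q
      emb-edge p q with edge p q in pq
      ... | true  = sound (emb-children p) (∈-map⁺ emb (complete (children-spec p) pq))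
      ... | false with G (emb p) (emb q) in g
      ...   | false = refl
      ...   | true with ∈-map⁻ emb (complete (emb-children p) g)
      ...     | c , c∈ , e with emb-injective e
      ...       | refl with trans (sym pq) (sound (children-spec p) c∈)
      ...         | ()

      iso : Iso (V , G) asGraph
      iso = mk↔ₛ′ to from to-from from-to , edges
        where
        preimage : Fin V → Pos
        preimage v = proj₁ (emb-surjective v)
        to : Fin V → Fin size
        to v = index (preimage v)
        from : Fin size → Fin V
        from i = emb (position i)
        to-from : ∀ i → to (from i) ≡ i
        to-from i = trans (cong index (emb-injective (proj₂ (emb-surjective (from i))))) (index-position i)
        from-to : ∀ v → from (to v) ≡ v
        from-to v = trans (cong emb (position-index (preimage v))) (proj₂ (emb-surjective v))
        edges : ∀ u v → G u v ≡ graph (to u) (to v)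
        edges u v = begin
          G u v                                  ≡⟨ cong₂ G (proj₂ (emb-surjective u)) (proj₂ (emb-surjective v)) ⟨
          G (emb (preimage u)) (emb (preimage v)) ≡⟨ emb-edge (preimage u) (preimage v) ⟩
          edge (preimage u) (preimage v)          ≡⟨ graph-index (preimage u) (preimage v) ⟨
          graph (to u) (to v)                     ∎
          where open ≡-Reasoning

  iso-root : ∀ (P Q : Positions) ((f , _) : Iso (PositionGraph.asGraph P) (PositionGraph.asGraph Q)) →
    Inverse.to f (PositionGraph.index P (Positions.root P)) ≡ PositionGraph.index Q (Positions.root Q)
  iso-root P Q iso@(f , _) = Q.parentless-root _ (trans (indeg-iso {G = P.graph} {H = Q.graph} iso (P.index P.root)) P.indeg-root)
    where
    module P = PositionGraph P
    module Q = PositionGraph Q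

module BinaryTrees where

  open import Data.Bool using (Bool; true; false)
  open import Data.Empty using (⊥; ⊥-elim)
  open import Data.Fin using (Fin; zero; suc)
  open import Data.List using (List; []; _∷_; [_]; map; length; _++_)
  open import Data.List.Properties using (length-map; length-++; map-∘)
  open import Data.List.Membership.Propositional using (_∈_)
  open import Data.List.Membership.Propositional.Properties using (∈-map⁺; ∈-map⁻; ∈-++⁺ˡ; ∈-++⁺ʳ; ∈-++⁻)
  open import Data.List.Relation.Unary.Any as Any using (Any; here; there)
  open import Data.List.Relation.Unary.AllPairs using ([]; _∷_)
  open import Data.List.Relation.Unary.All using ([])
  import Data.List.Relation.Unary.Unique.Propositional.Properties as Unique
  open import Data.Nat using (ℕ; zero; suc; _+_; _≤_; z≤n)
  open import Data.Nat.Properties using (n≮0; ≤-refl)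
  open import Data.Product using (Σ; _×_; _,_; proj₁; proj₂)
  open import Data.Sum using (_⊎_; inj₁; inj₂)
  open import Data.Unit using (tt)
  open import Function.Bundles using (_↔_; mk↔ₛ′; Inverse)
  open import Relation.Binary.PropositionalEquality using (_≡_; _≢_; refl; sym; trans; cong; cong₂; subst)

  open import Defs
  open Counting
  open Digraphs
  open Chains
  open Shapes
  open PositionGraphs

  data TPos : Shape → Set where
    ε     : ∀ {s} → TPos s
    left  : ∀ {a b} → TPos a → TPos (node a b)
    right : ∀ {a b} → TPos b → TPos (node a b)

  left-injective : ∀ {a b} {p q : TPos a} → left {b = b} p ≡ left q → p ≡ q
  left-injective refl = refl

  right-injective : ∀ {a b} {p q : TPos b} → right {a = a} p ≡ right q → p ≡ q
  right-injective refl = refl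

  tedge : ∀ {s} → TPos s → TPos s → Bool
  tedge {node _ _} ε (left ε)  = true
  tedge {node _ _} ε (right ε) = true
  tedge (left p)  (left q)  = tedge p q
  tedge (right p) (right q) = tedge p q
  tedge _ _ = false

  tchildren : ∀ {s} → TPos s → List (TPos s)
  tchildren {leaf}     ε = []
  tchildren {node _ _} ε = left ε ∷ right ε ∷ []
  tchildren (left p)  = map left (tchildren p)
  tchildren (right p) = map right (tchildren p)

  tparents : ∀ {s} → TPos s → List (TPos s)
  tparents ε                 = []
  tparents (left ε)          = [ ε ]
  tparents (left p@(left _))   = map left (tparents p)
  tparents (left p@(right _))  = map left (tparents p)
  tparents (right ε)         = [ ε ]
  tparents (right p@(left _))  = map right (tparents p)
  tparents (right p@(right _)) = map right (tparents p)

  private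
    below-left : ∀ {a b} (p : TPos a) {w} → tedge {node a b} (left p) w ≡ true → Σ (TPos a) λ q → w ≡ left q
    below-left p {left q} _ = q , refl

    below-right : ∀ {a b} (p : TPos b) {w} → tedge {node a b} (right p) w ≡ true → Σ (TPos b) λ q → w ≡ right q
    below-right p {right q} _ = q , refl

    above-left : ∀ {a b} (p : TPos a) → p ≢ ε → ∀ {w} → tedge {node a b} w (left p) ≡ true → Σ (TPos a) λ q → w ≡ left q
    above-left ε p≢ε {ε} _ = ⊥-elim (p≢ε refl)
    above-left p   _     {left q} _ = q , refl

    above-right : ∀ {a b} (p : TPos b) → p ≢ ε → ∀ {w} → tedge {node a b} w (right p) ≡ true → Σ (TPos b) λ q → w ≡ right q
    above-right ε p≢ε {ε} _ = ⊥-elim (p≢ε refl)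
    above-right p   _     {right q} _ = q , refl

  Children-left : ∀ {a b} {p : TPos a} {cs} → Children tedge p cs → Children (tedge {node a b}) (left p) (map left cs)
  Children-left {p = p} = ListsExactly-map left left-injective (λ e → e) (λ e → e) (below-left p)

  Children-right : ∀ {a b} {p : TPos b} {cs} → Children tedge p cs → Children (tedge {node a b}) (right p) (map right cs)
  Children-right {p = p} = ListsExactly-map right right-injective (λ e → e) (λ e → e) (below-right p)

  tchildren-spec : ∀ {s} (p : TPos s) → Children tedge p (tchildren p)
  tchildren-spec {leaf} ε = record { unique = [] ; sound = λ () ; complete = λ { {ε} () } }
  tchildren-spec {node a b} ε = record
    { unique = Unique-pair (λ ()) ; sound = λ { (here refl) → refl ; (there (here refl)) → refl }
    ; complete = λ { {left ε} _ → here refl ; {right ε} _ → there (here refl) } }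
  tchildren-spec (left p)  = Children-left (tchildren-spec p)
  tchildren-spec (right p) = Children-right (tchildren-spec p)

  tedge-ε : ∀ {s} (w : TPos s) → tedge w ε ≡ false
  tedge-ε {leaf}     ε = refl
  tedge-ε {node _ _} ε = refl
  tedge-ε (left _)     = refl
  tedge-ε (right _)    = refl

  private
    only-parent-ε : ∀ {s} {w : TPos s} → tedge w ε ≢ true
    only-parent-ε {w = w} e with trans (sym e) (tedge-ε w)
    ... | ()

  tparents-spec : ∀ {s} (p : TPos s) → Parents tedge p (tparents p)
  tparents-spec ε = record { unique = [] ; sound = λ () ; complete = λ {w} e → ⊥-elim (only-parent-ε {w = w} e) }
  tparents-spec (left ε) = record
    { unique = [] ∷ [] ; sound = λ { (here refl) → refl }
    ; complete = λ { {ε} _ → here refl ; {left w} e → ⊥-elim (only-parent-ε {w = w} e) } }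
  tparents-spec (right ε) = record
    { unique = [] ∷ [] ; sound = λ { (here refl) → refl }
    ; complete = λ { {ε} _ → here refl ; {right w} e → ⊥-elim (only-parent-ε {w = w} e) } }
  tparents-spec (left p@(left _))   = ListsExactly-map left left-injective (λ e → e) (λ e → e) (above-left p (λ ())) (tparents-spec p)
  tparents-spec (left p@(right _))  = ListsExactly-map left left-injective (λ e → e) (λ e → e) (above-left p (λ ())) (tparents-spec p)
  tparents-spec (right p@(left _))  = ListsExactly-map right right-injective (λ e → e) (λ e → e) (above-right p (λ ())) (tparents-spec p)
  tparents-spec (right p@(right _)) = ListsExactly-map right right-injective (λ e → e) (λ e → e) (above-right p (λ ())) (tparents-spec p)

  tlevel : ∀ {s} → TPos s → ℕ
  tlevel ε         = 0
  tlevel (left p)  = suc (tlevel p)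
  tlevel (right p) = suc (tlevel p)

  tlevel-edge : ∀ {s} {p q : TPos s} → tedge p q ≡ true → tlevel q ≡ suc (tlevel p)
  tlevel-edge {node _ _} {ε} {left ε}  _ = refl
  tlevel-edge {node _ _} {ε} {right ε} _ = refl
  tlevel-edge {p = left p}  {left q}  e = cong suc (tlevel-edge e)
  tlevel-edge {p = right p} {right q} e = cong suc (tlevel-edge e)

  tparents-single : ∀ {s} (p : TPos s) → p ≢ ε → length (tparents p) ≡ 1
  tparents-single ε                   p≢ε = ⊥-elim (p≢ε refl)
  tparents-single (left ε)            _ = refl
  tparents-single (left p@(left _))   _ = trans (length-map left (tparents p)) (tparents-single p λ ())
  tparents-single (left p@(right _))  _ = trans (length-map left (tparents p)) (tparents-single p λ ())
  tparents-single (right ε)           _ = refl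
  tparents-single (right p@(left _))  _ = trans (length-map right (tparents p)) (tparents-single p λ ())
  tparents-single (right p@(right _)) _ = trans (length-map right (tparents p)) (tparents-single p λ ())

  tparents-rooted : ∀ {s} (p : TPos s) → tparents p ≡ [] → p ≡ ε
  tparents-rooted ε         _ = refl
  tparents-rooted (left p)  e with trans (sym (tparents-single (left p) λ ())) (cong length e)
  ... | ()
  tparents-rooted (right p) e with trans (sym (tparents-single (right p) λ ())) (cong length e)
  ... | ()

  tchildren-length : ∀ {s} (p : TPos s) → length (tchildren p) ≡ 0 ⊎ length (tchildren p) ≡ 2
  tchildren-length {leaf}     ε = inj₁ refl
  tchildren-length {node _ _} ε = inj₂ refl
  tchildren-length {node _ b} (left p)  rewrite length-map (left {b = b}) (tchildren p)  = tchildren-length p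
  tchildren-length {node a _} (right p) rewrite length-map (right {a = a}) (tchildren p) = tchildren-length p

  tsize : Shape → ℕ
  tsize leaf       = 1
  tsize (node a b) = 1 + (tsize a + tsize b)

  tenum : ∀ s → TPos s ↔ Fin (tsize s)
  tenum leaf       = mk↔ₛ′ (λ _ → zero) (λ _ → ε) (λ { zero → refl ; (suc ()) }) (λ { ε → refl })
  tenum (node a b) = node-enum split (tenum a) (tenum b)
    where
    split : TPos (node a b) ↔ (Fin 1 ⊎ (TPos a ⊎ TPos b))
    split = mk↔ₛ′
      (λ { ε → inj₁ zero ; (left p) → inj₂ (inj₁ p) ; (right p) → inj₂ (inj₂ p) })
      (λ { (inj₁ _) → ε ; (inj₂ (inj₁ p)) → left p ; (inj₂ (inj₂ p)) → right p })
      (λ { (inj₁ zero) → refl ; (inj₁ (suc ())) ; (inj₂ (inj₁ p)) → refl ; (inj₂ (inj₂ p)) → refl })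
      (λ { ε → refl ; (left p) → refl ; (right p) → refl })

  treePositions : Shape → Positions
  treePositions s = record
    { Pos = TPos s ; size = tsize s ; enum = tenum s ; edge = tedge
    ; children = tchildren ; parents = tparents ; children-spec = tchildren-spec ; parents-spec = tparents-spec
    ; root = ε ; parents-root = refl ; rooted = tparents-rooted
    ; level = tlevel ; level-edge = tlevel-edge }

  treeGraph : Shape → Graph
  treeGraph s = PositionGraph.asGraph (treePositions s)

  tleaves : ∀ s → List (TPos s)
  tleaves leaf       = [ ε ]
  tleaves (node a b) = map left (tleaves a) ++ map right (tleaves b)

  tleaves-spec : ∀ s → ListsExactly (λ p → tchildren p ≡ []) (tleaves s)
  tleaves-spec leaf = record
    { unique = [] ∷ [] ; sound = λ { (here refl) → refl } ; complete = λ { {ε} _ → here refl } }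
  tleaves-spec (node a b) = record
    { unique   = Unique.++⁺ (Unique.map⁺ left-injective (unique La)) (Unique.map⁺ right-injective (unique Lb)) left≢right
    ; sound    = sound′
    ; complete = complete′
    }
    where
    La = tleaves-spec a
    Lb = tleaves-spec b
    left≢right : ∀ {w} → w ∈ map left (tleaves a) × w ∈ map right (tleaves b) → ⊥
    left≢right (w∈ₗ , w∈ᵣ) with ∈-map⁻ left w∈ₗ | ∈-map⁻ right w∈ᵣ
    ... | _ , _ , refl | _ , _ , ()
    sound′ : ∀ {p} → p ∈ tleaves (node a b) → tchildren p ≡ []
    sound′ p∈ with ∈-++⁻ (map left (tleaves a)) p∈
    ... | inj₁ p∈ₗ with ∈-map⁻ left p∈ₗ
    ...   | q , q∈ , refl = cong (map left) (sound La q∈)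
    sound′ p∈ | inj₂ p∈ᵣ with ∈-map⁻ right p∈ᵣ
    ...   | q , q∈ , refl = cong (map right) (sound Lb q∈)
    complete′ : ∀ {p} → tchildren p ≡ [] → p ∈ tleaves (node a b)
    complete′ {left q}  e = ∈-++⁺ˡ (∈-map⁺ left (complete La (length≡0 (trans (sym (length-map (left {b = b}) (tchildren q))) (cong length e)))))
    complete′ {right q} e = ∈-++⁺ʳ (map left (tleaves a)) (∈-map⁺ right (complete Lb (length≡0 (trans (sym (length-map (right {a = a}) (tchildren q))) (cong length e)))))

  length-tleaves : ∀ s → length (tleaves s) ≡ leaves s
  length-tleaves leaf       = refl
  length-tleaves (node a b) = trans (length-++ (map left (tleaves a)))
    (cong₂ _+_ (trans (length-map left (tleaves a)) (length-tleaves a)) (trans (length-map right (tleaves b)) (length-tleaves b)))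

  private
    tallowed-below : ∀ {s} (p : TPos s) → p ≢ ε → AllowedDegrees (length (tparents p)) (length (tchildren p))
    tallowed-below p p≢ε rewrite tparents-single p p≢ε with tchildren-length p
    ... | inj₁ o≡0 = inj₂ (inj₂ (inj₁ (refl , o≡0)))
    ... | inj₂ o≡2 = inj₂ (inj₁ (refl , o≡2))

  tallowed : ∀ {a b} (p : TPos (node a b)) → AllowedDegrees (length (tparents p)) (length (tchildren p))
  tallowed ε           = inj₁ (refl , refl)
  tallowed p@(left _)  = tallowed-below p (λ ())
  tallowed p@(right _) = tallowed-below p (λ ())

  treeGraph-leafCount : ∀ s → leafCount (treeGraph s) ≡ leaves s
  treeGraph-leafCount s = trans (PositionGraph.leafCount-graph (treePositions s) (tleaves-spec s)) (length-tleaves s)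

  treeGraph-binary : ∀ s → IsBinaryTree (treeGraph s)
  treeGraph-binary s = isNetwork (degrees s) , no-reticulation
    where
    open PositionGraph (treePositions s)
    degrees : ∀ t → tsize t ≡ 1 ⊎ (∀ (p : TPos t) → AllowedDegrees (length (tparents p)) (length (tchildren p)))
    degrees leaf       = inj₁ refl
    degrees (node a b) = inj₂ tallowed
    parents≢2 : ∀ (p : TPos s) → length (tparents p) ≢ 2
    parents≢2 ε ()
    parents≢2 p@(left _)  e with trans (sym (tparents-single p (λ ()))) e
    ... | ()
    parents≢2 p@(right _) e with trans (sym (tparents-single p (λ ()))) e
    ... | ()
    no-reticulation : ∀ v → indeg graph v ≢ 2
    no-reticulation v e = parents≢2 (position v) (trans (sym (indeg-graph-position v)) e)

  record Fork {A : Set} (E : A → A → Bool) (x : A) (P Q : A → Set) : Set where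
    field
      child₁   : A
      child₂   : A
      children : Children E x (child₁ ∷ child₂ ∷ [])
      below₁   : P child₁
      below₂   : Q child₂

  TreeShaped : ∀ {A : Set} → (A → A → Bool) → A → Shape → Set
  TreeShaped E x leaf       = Childless E x
  TreeShaped E x (node a b) = Fork E x (λ c → TreeShaped E c a) (λ c → TreeShaped E c b)

  module _ {A B : Set} {E : A → A → Bool} {E′ : B → B → Bool} (φ : A → B)
    (φ-Children : ∀ {x cs} → Children E x cs → Children E′ (φ x) (map φ cs)) where

    TreeShaped-map : ∀ {x} s → TreeShaped E x s → TreeShaped E′ (φ x) s
    TreeShaped-map leaf       noChild = φ-Children noChild
    TreeShaped-map (node a b) F = record
      { child₁ = φ child₁ ; child₂ = φ child₂ ; children = φ-Children children
      ; below₁ = TreeShaped-map a below₁ ; below₂ = TreeShaped-map b below₂ }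
      where open Fork F

  module _ {A : Set} {E : A → A → Bool} where

    TreeShaped-≅ : ∀ {x} s t → s ≅ t → TreeShaped E x s → TreeShaped E x t
    TreeShaped-≅ leaf leaf _ noChild = noChild
    TreeShaped-≅ (node a b) (node c d) (inj₁ (a≅c , b≅d)) F = record
      { child₁ = child₁ ; child₂ = child₂ ; children = children
      ; below₁ = TreeShaped-≅ a c a≅c below₁ ; below₂ = TreeShaped-≅ b d b≅d below₂ }
      where open Fork F
    TreeShaped-≅ (node a b) (node c d) (inj₂ (a≅d , b≅c)) F = record
      { child₁ = child₂ ; child₂ = child₁ ; children = ListsExactly-swap children
      ; below₁ = TreeShaped-≅ b c b≅c below₂ ; below₂ = TreeShaped-≅ a d a≅d below₁ }
      where open Fork F

    TreeShaped-unique : ∀ {x} s t → TreeShaped E x s → TreeShaped E x t → s ≅ t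
    TreeShaped-unique leaf leaf _ _ = tt
    TreeShaped-unique leaf (node _ _) noChild F = ⊥-elim (Childless-Children {E = E} noChild (Fork.children F))
    TreeShaped-unique (node _ _) leaf F noChild = ⊥-elim (Childless-Children {E = E} noChild (Fork.children F))
    TreeShaped-unique (node a b) (node c d) F F′ with ListsExactly-pair-unique (Fork.children F) (Fork.children F′)
    ... | inj₁ (refl , refl) = inj₁ (TreeShaped-unique a c (Fork.below₁ F) (Fork.below₁ F′) , TreeShaped-unique b d (Fork.below₂ F) (Fork.below₂ F′))
    ... | inj₂ (refl , refl) = inj₂ (TreeShaped-unique a d (Fork.below₁ F) (Fork.below₂ F′) , TreeShaped-unique b c (Fork.below₂ F) (Fork.below₁ F′))

  tshaped : ∀ s → TreeShaped tedge ε s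
  tshaped leaf       = tchildren-spec ε
  tshaped (node a b) = record
    { child₁ = left ε ; child₂ = right ε ; children = tchildren-spec ε
    ; below₁ = TreeShaped-map {E = tedge} {E′ = tedge {node a b}} left Children-left a (tshaped a)
    ; below₂ = TreeShaped-map {E = tedge} {E′ = tedge {node a b}} right Children-right b (tshaped b) }

  treeGraph-shaped : ∀ s → TreeShaped (PositionGraph.graph (treePositions s)) (PositionGraph.index (treePositions s) ε) s
  treeGraph-shaped s = TreeShaped-map {E = tedge} {E′ = graph} index Children-index s (tshaped s)
    where open PositionGraph (treePositions s)

  treeGraph-iso⇒≅ : ∀ {s t} → Iso (treeGraph s) (treeGraph t) → s ≅ t
  treeGraph-iso⇒≅ {s} {t} iso@(f , _) = TreeShaped-unique s t shaped-s (treeGraph-shaped t)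
    where
    module S = PositionGraph (treePositions s)
    module T = PositionGraph (treePositions t)
    shaped-s : TreeShaped T.graph (T.index ε) s
    shaped-s = subst (λ x → TreeShaped T.graph x s) (iso-root (treePositions s) (treePositions t) iso)
      (TreeShaped-map {E = S.graph} {E′ = T.graph} (Inverse.to f) (Children-iso {G = S.graph} {H = T.graph} iso) s (treeGraph-shaped s))

  module TreeRecognition {V : ℕ} (G : Digraph V) (acyclic : Acyclic G) (r : Fin V)
    (r-parentless : indeg G r ≡ 0) (only-root : ∀ v → indeg G v ≡ 0 → v ≡ r)
    (indeg≤1 : ∀ v → indeg G v ≤ 1) (outdeg-0or2 : ∀ v → outdeg G v ≡ 0 ⊎ outdeg G v ≡ 2) where

    shape-below : ∀ k x → Height {G = G} x k → Σ Shape λ s → TreeShaped G x s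
    shape-below k x h with outdeg-0or2 x
    ... | inj₁ o≡0 = leaf , outdeg≡0⇒Childless G o≡0
    ... | inj₂ o≡2 with outdeg≡2⇒Children G o≡2
    shape-below zero    x h | inj₂ _ | c₁ , _ , ch = ⊥-elim (n≮0 (h (direct (sound ch (here refl)))))
    shape-below (suc k) x h | inj₂ _ | c₁ , c₂ , ch
      with shape-below k c₁ (Height-child h (sound ch (here refl))) | shape-below k c₂ (Height-child h (sound ch (there (here refl))))
    ... | a , below₁ | b , below₂ = node a b , record
      { child₁ = c₁ ; child₂ = c₂ ; children = ch ; below₁ = below₁ ; below₂ = below₂ }

    embed : ∀ s {x} → TreeShaped G x s → TPos s → Fin V
    embed s          {x} _ ε         = x
    embed (node a b)     F (left p)  = embed a (Fork.below₁ F) p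
    embed (node a b)     F (right p) = embed b (Fork.below₂ F) p

    embed-children : ∀ s {x} (sh : TreeShaped G x s) p → Children G (embed s sh p) (map (embed s sh) (tchildren p))
    embed-children leaf       sh ε         = sh
    embed-children (node a b) F  ε         = Fork.children F
    embed-children (node a b) F  (left p)  =
      subst (Children G _) (map-∘ (tchildren p)) (embed-children a (Fork.below₁ F) p)
    embed-children (node a b) F  (right p) =
      subst (Children G _) (map-∘ (tchildren p)) (embed-children b (Fork.below₂ F) p)

    iso-of-shaped : ∀ s → TreeShaped G r s → Iso (V , G) (treeGraph s)
    iso-of-shaped s sh = Embedding.iso G emb (embed-children s sh) emb-parents (reachable-from-root acyclic r only-root)
      where
      open PositionGraph (treePositions s) using (Parents-embedding; module Embedding)
      emb = embed s sh
      single-parent : ∀ p → p ≢ ε → Parents G (emb p) (map emb (tparents p))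
      single-parent p p≢ε = Parents-embedding G emb (embed-children s sh) p
        (Unique-length≡1 (trans (length-map emb (tparents p)) (tparents-single p p≢ε)))
        (subst (indeg G (emb p) ≤_) (sym (tparents-single p p≢ε)) (indeg≤1 (emb p)))
      emb-parents : ∀ p → Parents G (emb p) (map emb (tparents p))
      emb-parents ε = indeg≡0⇒Parentless G r-parentless
      emb-parents p@(left _)  = single-parent p (λ ())
      emb-parents p@(right _) = single-parent p (λ ())

  private
    tree-degrees : ∀ {i o} → AllowedDegrees i o → i ≢ 2 → i ≤ 1 × (o ≡ 0 ⊎ o ≡ 2)
    tree-degrees (inj₁ (refl , o≡2))                 _   = z≤n , inj₂ o≡2
    tree-degrees (inj₂ (inj₁ (refl , o≡2)))          _   = ≤-refl , inj₂ o≡2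
    tree-degrees (inj₂ (inj₂ (inj₁ (refl , o≡0))))   _   = ≤-refl , inj₁ o≡0
    tree-degrees (inj₂ (inj₂ (inj₂ (i≡2 , _))))      i≢2 = ⊥-elim (i≢2 i≡2)

  binaryTree-degrees : ∀ {V} {G : Digraph V} → IsBinaryTree (V , G) →
    (∀ v → indeg G v ≤ 1) × (∀ v → outdeg G v ≡ 0 ⊎ outdeg G v ≡ 2)
  binaryTree-degrees {G = G} ((noLoops , _ , inj₁ refl) , _) =
    (λ v → subst (_≤ 1) (sym (single-vertex-indeg {G = G} noLoops v)) z≤n) , (λ v → inj₁ (single-vertex-outdeg {G = G} noLoops v))
  binaryTree-degrees ((_ , _ , inj₂ (allowed , _)) , no-reticulation) =
    (λ v → proj₁ (tree-degrees (allowed v) (no-reticulation v))) , (λ v → proj₂ (tree-degrees (allowed v) (no-reticulation v)))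

  treeGraph-complete : ∀ m H → BinTree (suc m) H → Any (λ s → Iso H (treeGraph s)) (shapeClasses m)
  treeGraph-complete m (V , G) (binary@(network@(_ , acyclic , _) , _) , leafCount≡) =
    Any.map (λ s≅u → iso-of-shaped _ (TreeShaped-≅ s _ s≅u shaped)) (shapeClasses-complete s leaves-s)
    where
    root = network-root network
    r = proj₁ root
    degrees = binaryTree-degrees binary
    open TreeRecognition G acyclic r (proj₁ (proj₂ root)) (proj₂ (proj₂ root)) (proj₁ degrees) (proj₂ degrees)
    built = shape-below V r (Height-bounded acyclic r)
    s = proj₁ built
    shaped = proj₂ built
    leaves-s : leaves s ≡ suc m
    leaves-s = trans (sym (treeGraph-leafCount s)) (trans (leafCount-iso (iso-of-shaped s shaped)) leafCount≡)

module RetCycles where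

  open import Data.Bool using (true)
  open import Data.Empty using (⊥-elim)
  open import Data.Fin using (Fin)
  import Data.Fin.Properties as Fin
  open import Data.List using (List; []; _∷_; _++_; [_]; length)
  open import Data.List.Membership.Propositional using (_∈_; find; lose)
  open import Data.List.Membership.Propositional.Properties using (∈-++⁺ˡ; ∈-++⁺ʳ)
  import Data.List.Membership.DecPropositional as DecMembership
  open import Data.List.Relation.Unary.Any using (here; there; any?)
  open import Data.Nat using (ℕ; suc; _<_; s≤s)
  open import Data.Nat.Properties using (≤-refl; ≤-trans; n≤1+n)
  open import Relation.Nullary using (yes; no)
  open import Data.Product using (Σ; _×_; _,_)
  open import Data.Sum using (_⊎_; inj₁; inj₂)
  open import Relation.Binary.PropositionalEquality using (_≡_; _≢_; refl; sym; trans; subst)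

  open import Defs
  open Digraphs
  open Chains

  module _ {V : ℕ} {G : Digraph V} where
    open DecMembership (Fin._≟_ {V}) using (_∈?_)

    swapCycle : RetCycle G → RetCycle G
    swapCycle C = record
      { top = top C ; ret = ret C ; p = q C ; q = p C ; pathP = pathQ C ; pathQ = pathP C
      ; disjoint = λ x x∈q x∈p → disjoint C x x∈p x∈q ; distinct = λ (q≡[] , p≡[]) → distinct C (p≡[] , q≡[]) }

    SameCycle-sym : ∀ {C D : RetCycle G} → SameCycle C D → SameCycle D C
    SameCycle-sym (t , r , inj₁ (p≡ , q≡)) = sym t , sym r , inj₁ (sym p≡ , sym q≡)
    SameCycle-sym (t , r , inj₂ (p≡ , q≡)) = sym t , sym r , inj₂ (sym q≡ , sym p≡)

    SameCycle-trans : ∀ {C D E : RetCycle G} → SameCycle C D → SameCycle D E → SameCycle C E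
    SameCycle-trans (t , r , inj₁ (a , b)) (t′ , r′ , inj₁ (a′ , b′)) = trans t t′ , trans r r′ , inj₁ (trans a a′ , trans b b′)
    SameCycle-trans (t , r , inj₁ (a , b)) (t′ , r′ , inj₂ (a′ , b′)) = trans t t′ , trans r r′ , inj₂ (trans a a′ , trans b b′)
    SameCycle-trans (t , r , inj₂ (a , b)) (t′ , r′ , inj₁ (a′ , b′)) = trans t t′ , trans r r′ , inj₂ (trans a b′ , trans b a′)
    SameCycle-trans (t , r , inj₂ (a , b)) (t′ , r′ , inj₂ (a′ , b′)) = trans t t′ , trans r r′ , inj₁ (trans a b′ , trans b a′)

    SameCycle-swap : ∀ {C D : RetCycle G} → SameCycle (swapCycle C) D → SameCycle C D
    SameCycle-swap (t , r , inj₁ (a , b)) = t , r , inj₂ (b , a)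
    SameCycle-swap (t , r , inj₂ (a , b)) = t , r , inj₁ (b , a)

    OnCycle-Same : ∀ {v} {C D : RetCycle G} → SameCycle C D → OnCycle v C → OnCycle v D
    OnCycle-Same (t , _ , _) (inj₁ v≡t)                    = inj₁ (trans v≡t t)
    OnCycle-Same (_ , r , _) (inj₂ (inj₁ v≡r))             = inj₂ (inj₁ (trans v≡r r))
    OnCycle-Same (_ , _ , inj₁ (a , _)) (inj₂ (inj₂ (inj₁ v∈p))) = inj₂ (inj₂ (inj₁ (subst (_ ∈_) a v∈p)))
    OnCycle-Same (_ , _ , inj₂ (a , _)) (inj₂ (inj₂ (inj₁ v∈p))) = inj₂ (inj₂ (inj₂ (subst (_ ∈_) a v∈p)))
    OnCycle-Same (_ , _ , inj₁ (_ , b)) (inj₂ (inj₂ (inj₂ v∈q))) = inj₂ (inj₂ (inj₂ (subst (_ ∈_) b v∈q)))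
    OnCycle-Same (_ , _ , inj₂ (_ , b)) (inj₂ (inj₂ (inj₂ v∈q))) = inj₂ (inj₂ (inj₁ (subst (_ ∈_) b v∈q)))

    last-step : ∀ {s xs t} → Chain G s xs t → Σ (Fin V) λ y → G y t ≡ true ×
      ((xs ≡ [] × y ≡ s) ⊎ Σ (List (Fin V)) λ ys → xs ≡ ys ++ [ y ] × Chain G s ys y)
    last-step {s} c with chain-last c
    ... | inj₁ (refl , e)              = s , e , inj₁ (refl , refl)
    ... | inj₂ (ys , y , refl , c′ , e) = y , e , inj₂ (ys , refl , c′)

    module _ (acyclic : Acyclic G) where

      private
        last-≢ : (C : RetCycle G) → ∀ {y₁ y₂} →
          ((p C ≡ [] × y₁ ≡ top C) ⊎ Σ (List (Fin V)) λ ys → p C ≡ ys ++ [ y₁ ] × Chain G (top C) ys y₁) →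
          ((q C ≡ [] × y₂ ≡ top C) ⊎ Σ (List (Fin V)) λ ys → q C ≡ ys ++ [ y₂ ] × Chain G (top C) ys y₂) → y₁ ≢ y₂
        last-≢ C (inj₁ (p≡[] , _)) (inj₁ (q≡[] , _)) _ = distinct C (p≡[] , q≡[])
        last-≢ C (inj₁ (_ , refl)) (inj₂ (ys , q≡ , _)) refl =
          source∉chain acyclic (pathQ C) (subst (top C ∈_) (sym q≡) (∈-++⁺ʳ ys (here refl)))
        last-≢ C (inj₂ (ys , p≡ , _)) (inj₁ (_ , refl)) refl =
          source∉chain acyclic (pathP C) (subst (top C ∈_) (sym p≡) (∈-++⁺ʳ ys (here refl)))
        last-≢ C {y} (inj₂ (ys , p≡ , _)) (inj₂ (zs , q≡ , _)) refl = disjoint C y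
          (subst (y ∈_) (sym p≡) (∈-++⁺ʳ ys (here refl))) (subst (y ∈_) (sym q≡) (∈-++⁺ʳ zs (here refl)))

      RetCycle-parents : (C : RetCycle G) → Σ (Fin V) λ u₁ → Σ (Fin V) λ u₂ →
        u₁ ≢ u₂ × G u₁ (ret C) ≡ true × G u₂ (ret C) ≡ true
      RetCycle-parents C with last-step (pathP C) | last-step (pathQ C)
      ... | y₁ , e₁ , end₁ | y₂ , e₂ , end₂ = y₁ , y₂ , last-≢ C end₁ end₂ , e₁ , e₂

      module Diamond {t a b h : Fin V} (a≢b : a ≢ b)
        (t→a : G t a ≡ true) (a→h : G a h ≡ true) (t→b : G t b ≡ true) (b→h : G b h ≡ true)
        (parents-h : ∀ {u} → G u h ≡ true → u ≡ a ⊎ u ≡ b)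
        (parent-a : ∀ {u} → G u a ≡ true → u ≡ t) (parent-b : ∀ {u} → G u b ≡ true → u ≡ t) where

        diamond : RetCycle G
        diamond = record
          { top = t ; ret = h ; p = [ a ] ; q = [ b ] ; pathP = step t→a (direct a→h) ; pathQ = step t→b (direct b→h)
          ; disjoint = λ { _ (here refl) (here x≡b) → a≢b x≡b } ; distinct = λ { (() , _) } }

        private
          data Approach (s : Fin V) (xs : List (Fin V)) (y : Fin V) : Set where
            from-side : xs ≡ [] → s ≡ y → Approach s xs y
            from-top  : xs ≡ [ y ] → s ≡ t → Approach s xs y
            via-top   : t ∈ xs → Approach s xs y

          approach : ∀ {s xs y} → (∀ {u} → G u y ≡ true → u ≡ t) →
            ((xs ≡ [] × y ≡ s) ⊎ Σ (List (Fin V)) λ ys → xs ≡ ys ++ [ y ] × Chain G s ys y) → Approach s xs y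
          approach parent-y (inj₁ (refl , refl)) = from-side refl refl
          approach parent-y (inj₂ (ys , refl , c)) with last-step c
          ... | _ , e , inj₁ (refl , refl) with parent-y e
          ...   | refl = from-top refl refl
          approach parent-y (inj₂ (ys , refl , c)) | _ , e , inj₂ (zs , refl , _) with parent-y e
          ...   | refl = via-top (∈-++⁺ˡ (∈-++⁺ʳ zs (here refl)))

          t≢a : t ≢ a
          t≢a t≡a = chain-source≢target acyclic (direct t→a) t≡a

          t≢b : t ≢ b
          t≢b t≡b = chain-source≢target acyclic (direct t→b) t≡b

          combine : (C : RetCycle G) → ret C ≡ h → Approach (top C) (p C) a → Approach (top C) (q C) b → SameCycle C diamond
          combine C r≡ (from-top p≡ s≡t) (from-top q≡ _) = s≡t , r≡ , inj₁ (p≡ , q≡)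
          combine C _ (from-side _ s≡a) (from-side _ s≡b) = ⊥-elim (a≢b (trans (sym s≡a) s≡b))
          combine C _ (from-side _ s≡a) (from-top _ s≡t)  = ⊥-elim (t≢a (trans (sym s≡t) s≡a))
          combine C _ (from-top _ s≡t) (from-side _ s≡b)  = ⊥-elim (t≢b (trans (sym s≡t) s≡b))
          combine C _ (from-side _ s≡a) (via-top t∈q) with chain-prefix (pathQ C) t∈q
          ... | ys , c = ⊥-elim (acyclic (top C) _ (chain-snoc c (subst (λ z → G t z ≡ true) (sym s≡a) t→a)))
          combine C _ (via-top t∈p) (from-side _ s≡b) with chain-prefix (pathP C) t∈p
          ... | ys , c = ⊥-elim (acyclic (top C) _ (chain-snoc c (subst (λ z → G t z ≡ true) (sym s≡b) t→b)))
          combine C _ (from-top _ s≡t) (via-top t∈q) = ⊥-elim (source∉chain acyclic (pathQ C) (subst (_∈ q C) (sym s≡t) t∈q))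
          combine C _ (via-top t∈p) (from-top _ s≡t) = ⊥-elim (source∉chain acyclic (pathP C) (subst (_∈ p C) (sym s≡t) t∈p))
          combine C _ (via-top t∈p) (via-top t∈q) = ⊥-elim (disjoint C t t∈p t∈q)

        diamond-unique : (C : RetCycle G) → ret C ≡ h → SameCycle C diamond
        diamond-unique C r≡h with last-step (pathP C) | last-step (pathQ C)
        ... | y₁ , e₁ , end₁ | y₂ , e₂ , end₂ with parents-h (subst (λ z → G y₁ z ≡ true) r≡h e₁) | parents-h (subst (λ z → G y₂ z ≡ true) r≡h e₂)
        ... | inj₁ refl | inj₂ refl = combine C r≡h (approach parent-a end₁) (approach parent-b end₂)
        ... | inj₂ refl | inj₁ refl = SameCycle-swap {C = C} {D = diamond} (combine (swapCycle C) r≡h (approach parent-a end₂) (approach parent-b end₁))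
        ... | inj₁ refl | inj₁ refl = ⊥-elim (last-≢ C end₁ end₂ refl)
        ... | inj₂ refl | inj₂ refl = ⊥-elim (last-≢ C end₁ end₂ refl)

    private
      Last : Fin V → List (Fin V) → Fin V
      Last s []       = s
      Last s (x ∷ xs) = Last x xs

      Last-snoc : ∀ s xs u → Last s (xs ++ [ u ]) ≡ u
      Last-snoc s []       u = refl
      Last-snoc s (x ∷ xs) u = Last-snoc x xs u

      suffix-Last : ∀ {s xs t y} → Chain G s xs t → y ∈ xs →
        Σ (List (Fin V)) λ ys → Chain G y ys t × length ys < length xs × Last y ys ≡ Last s xs
      suffix-Last (step e c) (here refl) = _ , c , ≤-refl , refl
      suffix-Last (step e c) (there y∈) with suffix-Last c y∈
      ... | ys , c′ , shorter , same = ys , c′ , ≤-trans shorter (n≤1+n _) , same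

      split-cycle : ∀ k s P Q {t} → length P < k → Chain G s P t → Chain G s Q t → Last s P ≢ Last s Q →
        Σ (RetCycle G) λ C → ret C ≡ t
      split-cycle (suc k) s P Q (s≤s P<k) cP cQ ends≢ with any? (_∈? Q) P
      ... | no P∩Q≡∅ = record
        { top = s ; ret = _ ; p = P ; q = Q ; pathP = cP ; pathQ = cQ
        ; disjoint = λ x x∈P x∈Q → P∩Q≡∅ (lose x∈P x∈Q)
        ; distinct = λ { (refl , refl) → ends≢ refl } } , refl
      ... | yes P∩Q with find P∩Q
      ...   | y , y∈P , y∈Q with suffix-Last cP y∈P | suffix-Last cQ y∈Q
      ...     | P′ , cP′ , shorter , endP | Q′ , cQ′ , _ , endQ =
        split-cycle k y P′ Q′ (≤-trans shorter P<k) cP′ cQ′ (λ e → ends≢ (trans (sym endP) (trans e endQ)))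

    two-parents⇒RetCycle : ∀ r → (∀ v → Reachable {G = G} r v) → ∀ {u₁ u₂ x} → u₁ ≢ u₂ →
      G u₁ x ≡ true → G u₂ x ≡ true → Σ (RetCycle G) λ C → ret C ≡ x
    two-parents⇒RetCycle r reachable {u₁} {u₂} {x} u₁≢u₂ e₁ e₂ with chain-via u₁ e₁ | chain-via u₂ e₂
      where
      chain-via : ∀ u → G u x ≡ true → Σ (List (Fin V)) λ P → Chain G r P x × Last r P ≡ u
      chain-via u e with reachable u
      ... | inj₁ refl      = [] , direct e , refl
      ... | inj₂ (xs , c) = xs ++ [ u ] , chain-snoc c e , Last-snoc r xs u
    ... | P , cP , endP | Q , cQ , endQ = split-cycle (suc (length P)) r P Q ≤-refl cP cQ
      (λ e → u₁≢u₂ (trans (sym endP) (trans e endQ)))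

module GalledTrees where

  open import Data.Bool using (Bool; true; false)
  open import Data.Empty using (⊥; ⊥-elim)
  open import Data.Fin using (Fin; zero; suc)
  open import Data.Maybe using (Maybe; just; nothing)
  open import Data.Maybe.Properties using (just-injective)
  open import Data.Vec using (Vec; tabulate; lookup)
  open import Data.Vec.Properties using (lookup∘tabulate)
  open import Data.Nat.Properties using (≤-refl)
  import Data.Maybe as Maybe
  open import Data.List using (List; []; _∷_; [_]; map; length; _++_)
  open import Data.List.Properties using (length-map; length-++)
  open import Data.List.Membership.Propositional using (_∈_; _∉_)
  open import Data.List.Membership.Propositional.Properties using (∈-map⁺; ∈-map⁻; ∈-++⁺ˡ; ∈-++⁺ʳ; ∈-++⁻)
  open import Data.List.Relation.Unary.All using ([]; _∷_)
  open import Data.List.Relation.Unary.All.Properties using (¬Any⇒All¬)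
  open import Data.List.Relation.Unary.AllPairs using ([]; _∷_)
  open import Data.List.Relation.Unary.Any as Any using (here; there)
  import Data.List.Relation.Unary.Unique.Propositional.Properties as Unique
  open import Data.Nat using (ℕ; zero; suc; _+_; _*_; _≤_; s≤s)
  open import Data.Product using (Σ; _×_; _,_; proj₁)
  open import Data.Sum using (_⊎_; inj₁; inj₂)
  open import Data.Unit using (tt)
  open import Function.Bundles using (_↔_; mk↔ₛ′; Inverse)
  open import Function using (case_of_)
  open import Relation.Nullary using (Dec; yes; no; ¬_)
  open import Relation.Binary.PropositionalEquality using (_≡_; _≢_; refl; sym; trans; cong; cong₂; subst; module ≡-Reasoning)
  open import Data.Nat.Tactic.RingSolver using (solve-∀)
  open import Data.Fin.Patterns using (0F; 1F; 2F; 3F; 4F)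

  open import Defs
  open Counting
  open Digraphs
  open Chains
  open Shapes
  open PositionGraphs
  open RetCycles

  -- Every internal node of the shape becomes a gall: the top ε has children side₁ and side₂, which both enter the
  -- reticulation hybrid (whose only child is the leaf tip) and carry the left and the right subtree respectively.
  data GPos : Shape → Set where
    ε                          : ∀ {s} → GPos s
    side₁ side₂ hybrid tip     : ∀ {a b} → GPos (node a b)
    left                       : ∀ {a b} → GPos a → GPos (node a b)
    right                      : ∀ {a b} → GPos b → GPos (node a b)

  left-injective : ∀ {a b} {p q : GPos a} → left {b = b} p ≡ left q → p ≡ q
  left-injective refl = refl

  right-injective : ∀ {a b} {p q : GPos b} → right {a = a} p ≡ right q → p ≡ q
  right-injective refl = refl

  gedge : ∀ {s} → GPos s → GPos s → Bool
  gedge {node _ _} ε side₁ = true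
  gedge {node _ _} ε side₂ = true
  gedge side₁ hybrid       = true
  gedge side₂ hybrid       = true
  gedge side₁ (left ε)     = true
  gedge side₂ (right ε)    = true
  gedge hybrid tip         = true
  gedge (left p)  (left q)  = gedge p q
  gedge (right p) (right q) = gedge p q
  gedge _ _ = false

  gchildren : ∀ {s} → GPos s → List (GPos s)
  gchildren {leaf}     ε = []
  gchildren {node _ _} ε = side₁ ∷ side₂ ∷ []
  gchildren side₁     = hybrid ∷ left ε ∷ []
  gchildren side₂     = hybrid ∷ right ε ∷ []
  gchildren hybrid    = [ tip ]
  gchildren tip       = []
  gchildren (left p)  = map left (gchildren p)
  gchildren (right p) = map right (gchildren p)

  gparents : ∀ {s} → GPos s → List (GPos s)
  gparents ε          = []
  gparents side₁      = [ ε ]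
  gparents side₂      = [ ε ]
  gparents hybrid     = side₁ ∷ side₂ ∷ []
  gparents tip        = [ hybrid ]
  gparents (left ε)   = [ side₁ ]
  gparents (left p)   = map left (gparents p)
  gparents (right ε)  = [ side₂ ]
  gparents (right p)  = map right (gparents p)

  gparents-left : ∀ {a b} (p : GPos a) → p ≢ ε → gparents (left {b = b} p) ≡ map left (gparents p)
  gparents-left ε p≢ε = ⊥-elim (p≢ε refl)
  gparents-left side₁     _ = refl
  gparents-left side₂     _ = refl
  gparents-left hybrid    _ = refl
  gparents-left tip       _ = refl
  gparents-left (left _)  _ = refl
  gparents-left (right _) _ = refl

  gparents-right : ∀ {a b} (p : GPos b) → p ≢ ε → gparents (right {a = a} p) ≡ map right (gparents p)
  gparents-right ε p≢ε = ⊥-elim (p≢ε refl)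
  gparents-right side₁     _ = refl
  gparents-right side₂     _ = refl
  gparents-right hybrid    _ = refl
  gparents-right tip       _ = refl
  gparents-right (left _)  _ = refl
  gparents-right (right _) _ = refl

  gedge-ε : ∀ {s} (w : GPos s) → gedge w ε ≡ false
  gedge-ε {leaf}     ε = refl
  gedge-ε {node _ _} ε = refl
  gedge-ε side₁     = refl
  gedge-ε side₂     = refl
  gedge-ε hybrid    = refl
  gedge-ε tip       = refl
  gedge-ε (left _)  = refl
  gedge-ε (right _) = refl

  private
    ε-parentless : ∀ {s} (w : GPos s) → gedge w ε ≡ true → ∀ {A : Set} → A
    ε-parentless w e with trans (sym (gedge-ε w)) e
    ... | ()

    below-left : ∀ {a b} (p : GPos a) {w} → gedge {node a b} (left p) w ≡ true → Σ (GPos a) λ q → w ≡ left q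
    below-left p {left q} _ = q , refl

    below-right : ∀ {a b} (p : GPos b) {w} → gedge {node a b} (right p) w ≡ true → Σ (GPos b) λ q → w ≡ right q
    below-right p {right q} _ = q , refl

    above-left : ∀ {a b} (p : GPos a) → p ≢ ε → ∀ {w} → gedge {node a b} w (left p) ≡ true → Σ (GPos a) λ q → w ≡ left q
    above-left ε p≢ε {side₁} _ = ⊥-elim (p≢ε refl)
    above-left p _   {left q} _ = q , refl

    above-right : ∀ {a b} (p : GPos b) → p ≢ ε → ∀ {w} → gedge {node a b} w (right p) ≡ true → Σ (GPos b) λ q → w ≡ right q
    above-right ε p≢ε {side₂} _ = ⊥-elim (p≢ε refl)
    above-right p _   {right q} _ = q , refl

  Children-left : ∀ {a b} {p : GPos a} {cs} → Children gedge p cs → Children (gedge {node a b}) (left p) (map left cs)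
  Children-left {p = p} = ListsExactly-map left left-injective (λ e → e) (λ e → e) (below-left p)

  Children-right : ∀ {a b} {p : GPos b} {cs} → Children gedge p cs → Children (gedge {node a b}) (right p) (map right cs)
  Children-right {p = p} = ListsExactly-map right right-injective (λ e → e) (λ e → e) (below-right p)

  private
    pair : ∀ {s} (x y : GPos s) → x ≢ y → ∀ {P : GPos s → Set} → P x → P y → (∀ {w} → P w → w ∈ x ∷ y ∷ []) → ListsExactly P (x ∷ y ∷ [])
    pair x y x≢y Px Py complete′ = record
      { unique = Unique-pair x≢y ; sound = λ { (here refl) → Px ; (there (here refl)) → Py } ; complete = complete′ }

    single : ∀ {s} (x : GPos s) {P : GPos s → Set} → P x → (∀ {w} → P w → w ∈ [ x ]) → ListsExactly P [ x ]
    single x Px complete′ = record { unique = [] ∷ [] ; sound = λ { (here refl) → Px } ; complete = complete′ }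

  gchildren-spec : ∀ {s} (p : GPos s) → Children gedge p (gchildren p)
  gchildren-spec {leaf} ε = record { unique = [] ; sound = λ () ; complete = λ { {ε} () } }
  gchildren-spec {node _ _} ε = pair side₁ side₂ (λ ()) refl refl λ { {side₁} _ → here refl ; {side₂} _ → there (here refl) }
  gchildren-spec side₁ = pair hybrid (left ε) (λ ()) refl refl λ { {hybrid} _ → here refl ; {left ε} _ → there (here refl) }
  gchildren-spec side₂ = pair hybrid (right ε) (λ ()) refl refl λ { {hybrid} _ → here refl ; {right ε} _ → there (here refl) }
  gchildren-spec hybrid = single tip refl λ { {tip} _ → here refl }
  gchildren-spec tip = record { unique = [] ; sound = λ () ; complete = λ { {ε} () ; {side₁} () ; {side₂} () ; {hybrid} () ; {tip} () ; {left _} () ; {right _} () } }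
  gchildren-spec (left p)  = Children-left (gchildren-spec p)
  gchildren-spec (right p) = Children-right (gchildren-spec p)

  private
    Parents-left : ∀ {a b} (p : GPos a) → p ≢ ε → Parents gedge p (gparents p) → Parents (gedge {node a b}) (left p) (gparents (left p))
    Parents-left p p≢ε pa = subst (Parents gedge (left p)) (sym (gparents-left p p≢ε))
      (ListsExactly-map left left-injective (λ e → e) (λ e → e) (above-left p p≢ε) pa)

    Parents-right : ∀ {a b} (p : GPos b) → p ≢ ε → Parents gedge p (gparents p) → Parents (gedge {node a b}) (right p) (gparents (right p))
    Parents-right p p≢ε pa = subst (Parents gedge (right p)) (sym (gparents-right p p≢ε))
      (ListsExactly-map right right-injective (λ e → e) (λ e → e) (above-right p p≢ε) pa)

  gparents-spec : ∀ {s} (p : GPos s) → Parents gedge p (gparents p)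
  gparents-spec ε = record { unique = [] ; sound = λ () ; complete = λ {w} e → ε-parentless w e }
  gparents-spec side₁  = single ε refl λ { {ε} _ → here refl }
  gparents-spec side₂  = single ε refl λ { {ε} _ → here refl }
  gparents-spec hybrid = pair side₁ side₂ (λ ()) refl refl λ { {side₁} _ → here refl ; {side₂} _ → there (here refl) }
  gparents-spec tip    = single hybrid refl λ { {hybrid} _ → here refl }
  gparents-spec (left ε)  = single side₁ refl λ { {side₁} _ → here refl ; {left w} e → ε-parentless w e }
  gparents-spec (right ε) = single side₂ refl λ { {side₂} _ → here refl ; {right w} e → ε-parentless w e }
  gparents-spec (left p@side₁)       = Parents-left p (λ ()) (gparents-spec p)
  gparents-spec (left p@side₂)       = Parents-left p (λ ()) (gparents-spec p)
  gparents-spec (left p@hybrid)      = Parents-left p (λ ()) (gparents-spec p)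
  gparents-spec (left p@tip)         = Parents-left p (λ ()) (gparents-spec p)
  gparents-spec (left p@(left _))    = Parents-left p (λ ()) (gparents-spec p)
  gparents-spec (left p@(right _))   = Parents-left p (λ ()) (gparents-spec p)
  gparents-spec (right p@side₁)      = Parents-right p (λ ()) (gparents-spec p)
  gparents-spec (right p@side₂)      = Parents-right p (λ ()) (gparents-spec p)
  gparents-spec (right p@hybrid)     = Parents-right p (λ ()) (gparents-spec p)
  gparents-spec (right p@tip)        = Parents-right p (λ ()) (gparents-spec p)
  gparents-spec (right p@(left _))   = Parents-right p (λ ()) (gparents-spec p)
  gparents-spec (right p@(right _))  = Parents-right p (λ ()) (gparents-spec p)

  glevel : ∀ {s} → GPos s → ℕ
  glevel ε         = 0
  glevel side₁     = 1
  glevel side₂     = 1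
  glevel hybrid    = 2
  glevel tip       = 3
  glevel (left p)  = 2 + glevel p
  glevel (right p) = 2 + glevel p

  glevel-edge : ∀ {s} {p q : GPos s} → gedge p q ≡ true → glevel q ≡ suc (glevel p)
  glevel-edge {node _ _} {ε} {side₁} _ = refl
  glevel-edge {node _ _} {ε} {side₂} _ = refl
  glevel-edge {p = side₁} {hybrid}   _ = refl
  glevel-edge {p = side₂} {hybrid}   _ = refl
  glevel-edge {p = side₁} {left ε}   _ = refl
  glevel-edge {p = side₂} {right ε}  _ = refl
  glevel-edge {p = hybrid} {tip}     _ = refl
  glevel-edge {p = left p}  {left q}  e = cong (2 +_) (glevel-edge {p = p} {q} e)
  glevel-edge {p = right p} {right q} e = cong (2 +_) (glevel-edge {p = p} {q} e)

  is-ε? : ∀ {s} (p : GPos s) → Dec (p ≡ ε)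
  is-ε? ε         = yes refl
  is-ε? side₁     = no λ ()
  is-ε? side₂     = no λ ()
  is-ε? hybrid    = no λ ()
  is-ε? tip       = no λ ()
  is-ε? (left _)  = no λ ()
  is-ε? (right _) = no λ ()

  gparents-rooted : ∀ {s} (p : GPos s) → gparents p ≡ [] → p ≡ ε
  gparents-rooted ε         _ = refl
  gparents-rooted {node a b} (left p) e with is-ε? p
  ... | yes refl = case e of λ ()
  ... | no p≢ε   = ⊥-elim (p≢ε (gparents-rooted p (length≡0
    (trans (sym (length-map (left {b = b}) (gparents p))) (cong length (trans (sym (gparents-left p p≢ε)) e))))))
  gparents-rooted {node a b} (right p) e with is-ε? p
  ... | yes refl = case e of λ ()
  ... | no p≢ε   = ⊥-elim (p≢ε (gparents-rooted p (length≡0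
    (trans (sym (length-map (right {a = a}) (gparents p))) (cong length (trans (sym (gparents-right p p≢ε)) e))))))

  private
    subshape-root : ∀ s → AllowedDegrees 1 (length (gchildren {s} ε))
    subshape-root leaf       = inj₂ (inj₂ (inj₁ (refl , refl)))
    subshape-root (node _ _) = inj₂ (inj₁ (refl , refl))

  gdegrees : ∀ {s} (p : GPos s) → p ≢ ε → AllowedDegrees (length (gparents p)) (length (gchildren p))
  gdegrees ε p≢ε    = ⊥-elim (p≢ε refl)
  gdegrees side₁  _ = inj₂ (inj₁ (refl , refl))
  gdegrees side₂  _ = inj₂ (inj₁ (refl , refl))
  gdegrees hybrid _ = inj₂ (inj₂ (inj₂ (refl , refl)))
  gdegrees tip    _ = inj₂ (inj₂ (inj₁ (refl , refl)))
  gdegrees {node a b} (left p) _ with is-ε? p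
  ... | yes refl rewrite length-map (left {b = b}) (gchildren {a} ε) = subshape-root a
  ... | no p≢ε rewrite gparents-left {b = b} p p≢ε | length-map (left {b = b}) (gparents p) | length-map (left {b = b}) (gchildren p) =
    gdegrees p p≢ε
  gdegrees {node a b} (right p) _ with is-ε? p
  ... | yes refl rewrite length-map (right {a = a}) (gchildren {b} ε) = subshape-root b
  ... | no p≢ε rewrite gparents-right {a = a} p p≢ε | length-map (right {a = a}) (gparents p) | length-map (right {a = a}) (gchildren p) =
    gdegrees p p≢ε

  gsize : Shape → ℕ
  gsize leaf       = 1
  gsize (node a b) = 5 + (gsize a + gsize b)

  genum : ∀ s → GPos s ↔ Fin (gsize s)
  genum leaf       = mk↔ₛ′ (λ _ → zero) (λ _ → ε) (λ { zero → refl ; (suc ()) }) (λ { ε → refl })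
  genum (node a b) = node-enum split (genum a) (genum b)
    where
    split : GPos (node a b) ↔ (Fin 5 ⊎ (GPos a ⊎ GPos b))
    split = mk↔ₛ′
      (λ { ε → inj₁ 0F ; side₁ → inj₁ 1F ; side₂ → inj₁ 2F ; hybrid → inj₁ 3F ; tip → inj₁ 4F
         ; (left p) → inj₂ (inj₁ p) ; (right p) → inj₂ (inj₂ p) })
      (λ { (inj₁ 0F) → ε ; (inj₁ 1F) → side₁ ; (inj₁ 2F) → side₂ ; (inj₁ 3F) → hybrid ; (inj₁ 4F) → tip
         ; (inj₂ (inj₁ p)) → left p ; (inj₂ (inj₂ p)) → right p })
      (λ { (inj₁ 0F) → refl ; (inj₁ 1F) → refl ; (inj₁ 2F) → refl ; (inj₁ 3F) → refl ; (inj₁ 4F) → refl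
         ; (inj₂ (inj₁ p)) → refl ; (inj₂ (inj₂ p)) → refl })
      (λ { ε → refl ; side₁ → refl ; side₂ → refl ; hybrid → refl ; tip → refl ; (left p) → refl ; (right p) → refl })

  galledPositions : Shape → Positions
  galledPositions s = record
    { Pos = GPos s ; size = gsize s ; enum = genum s ; edge = gedge
    ; children = gchildren ; parents = gparents ; children-spec = gchildren-spec ; parents-spec = gparents-spec
    ; root = ε ; parents-root = refl ; rooted = gparents-rooted
    ; level = glevel ; level-edge = λ {p} {q} → glevel-edge {p = p} {q} }

  galledGraph : Shape → Graph
  galledGraph s = PositionGraph.asGraph (galledPositions s)

  gleaves : ∀ s → List (GPos s)
  gleaves leaf       = [ ε ]
  gleaves (node a b) = tip ∷ map left (gleaves a) ++ map right (gleaves b)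

  gleaves-spec : ∀ s → ListsExactly (λ p → gchildren p ≡ []) (gleaves s)
  gleaves-spec leaf = record
    { unique = [] ∷ [] ; sound = λ { (here refl) → refl } ; complete = λ { {ε} _ → here refl } }
  gleaves-spec (node a b) = record
    { unique   = ¬Any⇒All¬ _ tip∉ ∷ Unique.++⁺ (Unique.map⁺ left-injective (unique La)) (Unique.map⁺ right-injective (unique Lb)) left≢right
    ; sound    = sound′
    ; complete = complete′
    }
    where
    La = gleaves-spec a
    Lb = gleaves-spec b
    tip∉ : tip ∉ map left (gleaves a) ++ map right (gleaves b)
    tip∉ tip∈ with ∈-++⁻ (map left (gleaves a)) tip∈
    ... | inj₁ tip∈ₗ with ∈-map⁻ left tip∈ₗ
    ...   | _ , _ , ()
    tip∉ tip∈ | inj₂ tip∈ᵣ with ∈-map⁻ right tip∈ᵣ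
    ...   | _ , _ , ()
    left≢right : ∀ {w} → w ∈ map left (gleaves a) × w ∈ map right (gleaves b) → ⊥
    left≢right (w∈ₗ , w∈ᵣ) with ∈-map⁻ left w∈ₗ | ∈-map⁻ right w∈ᵣ
    ... | _ , _ , refl | _ , _ , ()
    sound′ : ∀ {p} → p ∈ gleaves (node a b) → gchildren p ≡ []
    sound′ (here refl) = refl
    sound′ (there p∈) with ∈-++⁻ (map left (gleaves a)) p∈
    ... | inj₁ p∈ₗ with ∈-map⁻ left p∈ₗ
    ...   | q , q∈ , refl = cong (map left) (sound La q∈)
    sound′ (there p∈) | inj₂ p∈ᵣ with ∈-map⁻ right p∈ᵣ
    ...   | q , q∈ , refl = cong (map right) (sound Lb q∈)
    complete′ : ∀ {p} → gchildren p ≡ [] → p ∈ gleaves (node a b)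
    complete′ {tip}     _ = here refl
    complete′ {left q}  e = there (∈-++⁺ˡ (∈-map⁺ left (complete La (length≡0 (trans (sym (length-map (left {b = b}) (gchildren q))) (cong length e))))))
    complete′ {right q} e = there (∈-++⁺ʳ (map left (gleaves a)) (∈-map⁺ right (complete Lb (length≡0 (trans (sym (length-map (right {a = a}) (gchildren q))) (cong length e))))))

  private
    two-galls-joined : ∀ x y → suc ((2 * x + 1) + (2 * y + 1)) ≡ 2 * suc (x + y) + 1
    two-galls-joined = solve-∀

  length-gleaves : ∀ s → length (gleaves s) ≡ 2 * internal s + 1
  length-gleaves leaf       = refl
  length-gleaves (node a b) = begin
    suc (length (map left (gleaves a) ++ map right (gleaves b)))          ≡⟨ cong suc (length-++ (map left (gleaves a))) ⟩
    suc (length (map left (gleaves a)) + length (map right (gleaves b)))  ≡⟨ cong suc (cong₂ _+_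
      (trans (length-map left (gleaves a)) (length-gleaves a)) (trans (length-map right (gleaves b)) (length-gleaves b))) ⟩
    suc ((2 * internal a + 1) + (2 * internal b + 1))                    ≡⟨ two-galls-joined (internal a) (internal b) ⟩
    2 * internal (node a b) + 1                                           ∎
    where open ≡-Reasoning

  galledGraph-leafCount : ∀ s → leafCount (galledGraph s) ≡ 2 * internal s + 1
  galledGraph-leafCount s = trans (PositionGraph.leafCount-graph (galledPositions s) (gleaves-spec s)) (length-gleaves s)

  galledGraph-network : ∀ s → IsNetwork (galledGraph s)
  galledGraph-network s = PositionGraph.isNetwork (galledPositions s) (degrees s)
    where
    degrees : ∀ t → gsize t ≡ 1 ⊎ (∀ (p : GPos t) → AllowedDegrees (length (gparents p)) (length (gchildren p)))
    degrees leaf       = inj₁ refl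
    degrees (node a b) = inj₂ λ p → case is-ε? p of λ { (yes refl) → inj₁ (refl , refl) ; (no p≢ε) → gdegrees p p≢ε }

  data Gall : Shape → Set where
    this : ∀ {a b} → Gall (node a b)
    inˡ  : ∀ {a b} → Gall a → Gall (node a b)
    inʳ  : ∀ {a b} → Gall b → Gall (node a b)

  -- at g x is the copy of the local vertex x (ε, side₁, side₂, hybrid or tip) in the gall of the node g.
  at : ∀ {s} → Gall s → (∀ {a b} → GPos (node a b)) → GPos s
  at this    x = x
  at (inˡ g) x = left (at g x)
  at (inʳ g) x = right (at g x)

  at-≢ε : ∀ {s} (g : Gall s) {x : ∀ {a b} → GPos (node a b)} → (∀ {a b} → x {a} {b} ≢ ε) → at g x ≢ ε
  at-≢ε this    x≢ε = x≢ε
  at-≢ε (inˡ g) _   ()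
  at-≢ε (inʳ g) _   ()

  gparents-hybrid : ∀ {s} (g : Gall s) → gparents (at g hybrid) ≡ at g side₁ ∷ at g side₂ ∷ []
  gparents-hybrid this    = refl
  gparents-hybrid (inˡ g) = trans (gparents-left (at g hybrid) (at-≢ε g λ ())) (cong (map left) (gparents-hybrid g))
  gparents-hybrid (inʳ g) = trans (gparents-right (at g hybrid) (at-≢ε g λ ())) (cong (map right) (gparents-hybrid g))

  gparents-side₁ : ∀ {s} (g : Gall s) → gparents (at g side₁) ≡ [ at g ε ]
  gparents-side₁ this    = refl
  gparents-side₁ (inˡ g) = trans (gparents-left (at g side₁) (at-≢ε g λ ())) (cong (map left) (gparents-side₁ g))
  gparents-side₁ (inʳ g) = trans (gparents-right (at g side₁) (at-≢ε g λ ())) (cong (map right) (gparents-side₁ g))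

  gparents-side₂ : ∀ {s} (g : Gall s) → gparents (at g side₂) ≡ [ at g ε ]
  gparents-side₂ this    = refl
  gparents-side₂ (inˡ g) = trans (gparents-left (at g side₂) (at-≢ε g λ ())) (cong (map left) (gparents-side₂ g))
  gparents-side₂ (inʳ g) = trans (gparents-right (at g side₂) (at-≢ε g λ ())) (cong (map right) (gparents-side₂ g))

  gchildren-top : ∀ {s} (g : Gall s) → gchildren (at g ε) ≡ at g side₁ ∷ at g side₂ ∷ []
  gchildren-top this    = refl
  gchildren-top (inˡ g) = cong (map left) (gchildren-top g)
  gchildren-top (inʳ g) = cong (map right) (gchildren-top g)

  gchildren-hybrid : ∀ {s} (g : Gall s) → gchildren (at g hybrid) ≡ [ at g tip ]
  gchildren-hybrid this    = refl
  gchildren-hybrid (inˡ g) = cong (map left) (gchildren-hybrid g)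
  gchildren-hybrid (inʳ g) = cong (map right) (gchildren-hybrid g)

  gchildren-tip : ∀ {s} (g : Gall s) → gchildren (at g tip) ≡ []
  gchildren-tip this    = refl
  gchildren-tip (inˡ g) = cong (map left) (gchildren-tip g)
  gchildren-tip (inʳ g) = cong (map right) (gchildren-tip g)

  two-parents⇒hybrid : ∀ {s} (p : GPos s) → 2 ≤ length (gparents p) → Σ (Gall s) λ g → p ≡ at g hybrid
  two-parents⇒hybrid hybrid _ = this , refl
  two-parents⇒hybrid ε     ()
  two-parents⇒hybrid side₁ (s≤s ())
  two-parents⇒hybrid side₂ (s≤s ())
  two-parents⇒hybrid tip   (s≤s ())
  two-parents⇒hybrid {node a b} (left p) 2≤ with is-ε? p
  ... | yes refl = case 2≤ of λ { (s≤s ()) }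
  ... | no p≢ε with two-parents⇒hybrid p (subst (2 ≤_) (trans (cong length (gparents-left {b = b} p p≢ε)) (length-map left (gparents p))) 2≤)
  ...   | g , refl = inˡ g , refl
  two-parents⇒hybrid {node a b} (right p) 2≤ with is-ε? p
  ... | yes refl = case 2≤ of λ { (s≤s ()) }
  ... | no p≢ε with two-parents⇒hybrid p (subst (2 ≤_) (trans (cong length (gparents-right {a = a} p p≢ε)) (length-map right (gparents p))) 2≤)
  ...   | g , refl = inʳ g , refl

  gallOf : ∀ {s} → GPos s → Maybe (Gall s)
  gallOf {leaf}     ε = nothing
  gallOf {node _ _} ε = just this
  gallOf side₁        = just this
  gallOf side₂        = just this
  gallOf hybrid       = just this
  gallOf tip          = nothing
  gallOf (left p)     = Maybe.map inˡ (gallOf p)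
  gallOf (right p)    = Maybe.map inʳ (gallOf p)

  gallOf-at : ∀ {s} (g : Gall s) {x : ∀ {a b} → GPos (node a b)} → (∀ {a b} → gallOf (x {a} {b}) ≡ just this) →
    gallOf (at g x) ≡ just g
  gallOf-at this    x-local = x-local
  gallOf-at (inˡ g) x-local = cong (Maybe.map inˡ) (gallOf-at g x-local)
  gallOf-at (inʳ g) x-local = cong (Maybe.map inʳ) (gallOf-at g x-local)

  gallEnum : ∀ s → Gall s ↔ Fin (internal s)
  gallEnum leaf       = mk↔ₛ′ (λ ()) (λ ()) (λ ()) (λ ())
  gallEnum (node a b) = node-enum split (gallEnum a) (gallEnum b)
    where
    split : Gall (node a b) ↔ (Fin 1 ⊎ (Gall a ⊎ Gall b))
    split = mk↔ₛ′
      (λ { this → inj₁ zero ; (inˡ g) → inj₂ (inj₁ g) ; (inʳ g) → inj₂ (inj₂ g) })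
      (λ { (inj₁ _) → this ; (inj₂ (inj₁ g)) → inˡ g ; (inj₂ (inj₂ g)) → inʳ g })
      (λ { (inj₁ zero) → refl ; (inj₁ (suc ())) ; (inj₂ (inj₁ g)) → refl ; (inj₂ (inj₂ g)) → refl })
      (λ { this → refl ; (inˡ g) → refl ; (inʳ g) → refl })

  module GallsOf (s : Shape) where
    open PositionGraph (galledPositions s)

    module _ (g : Gall s) where
      private
        parents-hybrid : Parents graph (index (at g hybrid)) (index (at g side₁) ∷ index (at g side₂) ∷ [])
        parents-hybrid = subst (λ ps → Parents graph (index (at g hybrid)) (map index ps)) (gparents-hybrid g) (Parents-graph (at g hybrid))
        parents-side₁ : Parents graph (index (at g side₁)) [ index (at g ε) ]
        parents-side₁ = subst (λ ps → Parents graph (index (at g side₁)) (map index ps)) (gparents-side₁ g) (Parents-graph (at g side₁))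
        parents-side₂ : Parents graph (index (at g side₂)) [ index (at g ε) ]
        parents-side₂ = subst (λ ps → Parents graph (index (at g side₂)) (map index ps)) (gparents-side₂ g) (Parents-graph (at g side₂))

      open Diamond acyclic (Unique-pair⁻ (unique parents-hybrid))
        (sound parents-side₁ (here refl)) (sound parents-hybrid (here refl))
        (sound parents-side₂ (here refl)) (sound parents-hybrid (there (here refl)))
        (ListsExactly-pair parents-hybrid) (ListsExactly-singleton parents-side₁) (ListsExactly-singleton parents-side₂)
        public renaming (diamond to gallCycle; diamond-unique to gallCycle-unique)

    classify : (C : RetCycle graph) → Σ (Gall s) λ g → SameCycle C (gallCycle g)
    classify C with RetCycle-parents acyclic C
    ... | u₁ , u₂ , u₁≢u₂ , e₁ , e₂
      with two-parents⇒hybrid (position (ret C))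
        (subst (2 ≤_) (indeg-graph-position (ret C)) (two-parents⇒2≤indeg graph u₁≢u₂ e₁ e₂))
    ...   | g , ret≡ = g , gallCycle-unique g C (trans (sym (index-position (ret C))) (cong index ret≡))

    private
      on-gall : ∀ {v} g → OnCycle v (gallCycle g) → gallOf (position v) ≡ just g
      on-gall g (inj₁ refl)                          = trans (cong gallOf (position-index _)) (gallOf-at g refl)
      on-gall g (inj₂ (inj₁ refl))                   = trans (cong gallOf (position-index _)) (gallOf-at g refl)
      on-gall g (inj₂ (inj₂ (inj₁ (here refl))))     = trans (cong gallOf (position-index _)) (gallOf-at g refl)
      on-gall g (inj₂ (inj₂ (inj₂ (here refl))))     = trans (cong gallOf (position-index _)) (gallOf-at g refl)

    galled : ∀ v (C D : RetCycle graph) → OnCycle v C → OnCycle v D → SameCycle C D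
    galled v C D onC onD with classify C | classify D
    ... | g , C∼g | h , D∼h
      with just-injective (trans (sym (on-gall g (OnCycle-Same {C = C} {D = gallCycle g} C∼g onC))) (on-gall h (OnCycle-Same {C = D} {D = gallCycle h} D∼h onD)))
    ...   | refl = SameCycle-trans {C = C} {D = gallCycle g} {E = D} C∼g (SameCycle-sym {C = D} {D = gallCycle g} D∼h)

    timeConsistent : TimeConsistent (galledGraph s)
    timeConsistent C with classify C
    ... | g , _ , _ , inj₁ (p≡ , q≡) = (λ p≡[] → case trans (sym p≡) p≡[] of λ ()) , (λ q≡[] → case trans (sym q≡) q≡[] of λ ())
    ... | g , _ , _ , inj₂ (p≡ , q≡) = (λ p≡[] → case trans (sym p≡) p≡[] of λ ()) , (λ q≡[] → case trans (sym q≡) q≡[] of λ ())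

    simplex : Simplex (galledGraph s)
    simplex r c indeg≡2 r→c
      with two-parents⇒hybrid (position r) (subst (2 ≤_) (trans (sym indeg≡2) (indeg-graph-position r)) ≤-refl)
    ... | g , r≡ = trans (cong (outdeg graph) c≡) (trans (outdeg-graph (at g tip)) (cong length (gchildren-tip g)))
      where
      r≡′ : r ≡ index (at g hybrid)
      r≡′ = trans (sym (index-position r)) (cong index r≡)
      c≡ : c ≡ index (at g tip)
      c≡ = ListsExactly-singleton (subst (λ cs → Children graph (index (at g hybrid)) (map index cs)) (gchildren-hybrid g) (Children-graph (at g hybrid)))
        (subst (λ x → graph x c ≡ true) r≡′ r→c)

    hasGallCount : HasGallCount (galledGraph s) (internal s)
    hasGallCount = cycles , distinct′ , cover
      where
      open Inverse (gallEnum s) using (to; from; strictlyInverseˡ; strictlyInverseʳ)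
      cycles : Vec (RetCycle graph) (internal s)
      cycles = tabulate (λ i → gallCycle (from i))
      cycles-≡ : ∀ i → lookup cycles i ≡ gallCycle (from i)
      cycles-≡ = lookup∘tabulate (λ i → gallCycle (from i))
      distinct′ : ∀ i j → i ≢ j → ¬ SameCycle (lookup cycles i) (lookup cycles j)
      distinct′ i j i≢j same rewrite cycles-≡ i | cycles-≡ j = i≢j (begin
        i                                  ≡⟨ strictlyInverseˡ i ⟨
        to (from i)                        ≡⟨ cong to (just-injective (trans (sym (gallOf-at (from i) refl))
                                                (trans (cong gallOf (index-injective (proj₁ same))) (gallOf-at (from j) refl)))) ⟩
        to (from j)                        ≡⟨ strictlyInverseˡ j ⟩
        j                                  ∎)
        where open ≡-Reasoning
      cover : (C : RetCycle graph) → Σ (Fin (internal s)) λ i → SameCycle C (lookup cycles i)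
      cover C with classify C
      ... | g , C∼g = to g , subst (SameCycle C) (sym (trans (cycles-≡ (to g)) (cong gallCycle (strictlyInverseʳ g)))) C∼g

  galledGraph-SimplexTCGalled : ∀ s m → internal s ≡ m → SimplexTCGalled (2 * m + 1) m (galledGraph s)
  galledGraph-SimplexTCGalled s m refl =
    (galledGraph-network s , galled) , timeConsistent , simplex , galledGraph-leafCount s , hasGallCount
    where open GallsOf s

  record GallBelow {A : Set} (E : A → A → Bool) (x : A) (P Q : A → Set) : Set where
    field
      side-left side-right hybrid-vertex tip-vertex root-left root-right : A
      top-children        : Children E x (side-left ∷ side-right ∷ [])
      side-left-children  : Children E side-left (hybrid-vertex ∷ root-left ∷ [])
      side-right-children : Children E side-right (hybrid-vertex ∷ root-right ∷ [])
      hybrid-children     : Children E hybrid-vertex [ tip-vertex ]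
      tip-childless       : Childless E tip-vertex
      shaped-left          : P root-left
      shaped-right         : Q root-right

  GallShaped : ∀ {A : Set} → (A → A → Bool) → A → Shape → Set
  GallShaped E x leaf       = Childless E x
  GallShaped E x (node a b) = GallBelow E x (λ c → GallShaped E c a) (λ c → GallShaped E c b)

  module _ {A B : Set} {E : A → A → Bool} {E′ : B → B → Bool} (φ : A → B)
    (φ-Children : ∀ {x cs} → Children E x cs → Children E′ (φ x) (map φ cs)) where

    GallShaped-map : ∀ {x} s → GallShaped E x s → GallShaped E′ (φ x) s
    GallShaped-map leaf       noChild = φ-Children noChild
    GallShaped-map (node a b) B = record
      { side-left = φ side-left ; side-right = φ side-right ; hybrid-vertex = φ hybrid-vertex ; tip-vertex = φ tip-vertex
      ; root-left = φ root-left ; root-right = φ root-right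
      ; top-children = φ-Children top-children ; side-left-children = φ-Children side-left-children
      ; side-right-children = φ-Children side-right-children ; hybrid-children = φ-Children hybrid-children
      ; tip-childless = φ-Children tip-childless
      ; shaped-left = GallShaped-map a shaped-left ; shaped-right = GallShaped-map b shaped-right }
      where open GallBelow B

  module _ {A : Set} {E : A → A → Bool} where

    GallShaped-≅ : ∀ {x} s t → s ≅ t → GallShaped E x s → GallShaped E x t
    GallShaped-≅ leaf leaf _ noChild = noChild
    GallShaped-≅ (node a b) (node c d) (inj₁ (a≅c , b≅d)) B = record
      { side-left = side-left ; side-right = side-right ; hybrid-vertex = hybrid-vertex ; tip-vertex = tip-vertex
      ; root-left = root-left ; root-right = root-right
      ; top-children = top-children ; side-left-children = side-left-children ; side-right-children = side-right-children
      ; hybrid-children = hybrid-children ; tip-childless = tip-childless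
      ; shaped-left = GallShaped-≅ a c a≅c shaped-left ; shaped-right = GallShaped-≅ b d b≅d shaped-right }
      where open GallBelow B
    GallShaped-≅ (node a b) (node c d) (inj₂ (a≅d , b≅c)) B = record
      { side-left = side-right ; side-right = side-left ; hybrid-vertex = hybrid-vertex ; tip-vertex = tip-vertex
      ; root-left = root-right ; root-right = root-left
      ; top-children = ListsExactly-swap top-children ; side-left-children = side-right-children
      ; side-right-children = side-left-children ; hybrid-children = hybrid-children ; tip-childless = tip-childless
      ; shaped-left = GallShaped-≅ b c b≅c shaped-right ; shaped-right = GallShaped-≅ a d a≅d shaped-left }
      where open GallBelow B

    private
      GallShaped-not-single : ∀ {x c} s → GallShaped E x s → Children E x [ c ] → ⊥
      GallShaped-not-single leaf       noChild ch = Childless-Children {E = E} noChild ch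
      GallShaped-not-single (node _ _) B       ch = Unique-pair⁻ (unique top-children)
        (trans (ListsExactly-singleton ch (sound top-children (here refl)))
               (sym (ListsExactly-singleton ch (sound top-children (there (here refl))))))
        where open GallBelow B

      side-determined : ∀ {y h c h′ c′ t a′} → Children E y (h ∷ c ∷ []) → Children E y (h′ ∷ c′ ∷ []) →
        Children E h [ t ] → GallShaped E c′ a′ → h′ ≡ h × c′ ≡ c
      side-determined {a′ = a′} chs chs′ hybrid-ch below′ with ListsExactly-pair-unique chs chs′
      ... | inj₁ same = same
      ... | inj₂ (_ , refl) = ⊥-elim (GallShaped-not-single a′ below′ hybrid-ch)

    GallShaped-unique : ∀ {x} s t → GallShaped E x s → GallShaped E x t → s ≅ t
    GallShaped-unique leaf leaf _ _ = tt
    GallShaped-unique leaf (node _ _) noChild B = ⊥-elim (Childless-Children {E = E} noChild (GallBelow.top-children B))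
    GallShaped-unique (node _ _) leaf B noChild = ⊥-elim (Childless-Children {E = E} noChild (GallBelow.top-children B))
    GallShaped-unique (node a b) (node c d) B B′ with ListsExactly-pair-unique (GallBelow.top-children B) (GallBelow.top-children B′)
    ... | inj₁ (refl , refl)
      with side-determined (GallBelow.side-left-children B) (GallBelow.side-left-children B′) (GallBelow.hybrid-children B) (GallBelow.shaped-left B′)
         | side-determined (GallBelow.side-right-children B) (GallBelow.side-right-children B′) (GallBelow.hybrid-children B) (GallBelow.shaped-right B′)
    ...   | refl , refl | _ , refl = inj₁ (GallShaped-unique a c (GallBelow.shaped-left B) (GallBelow.shaped-left B′)
                                         , GallShaped-unique b d (GallBelow.shaped-right B) (GallBelow.shaped-right B′))
    GallShaped-unique (node a b) (node c d) B B′ | inj₂ (refl , refl)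
      with side-determined (GallBelow.side-left-children B) (GallBelow.side-right-children B′) (GallBelow.hybrid-children B) (GallBelow.shaped-right B′)
         | side-determined (GallBelow.side-right-children B) (GallBelow.side-left-children B′) (GallBelow.hybrid-children B) (GallBelow.shaped-left B′)
    ...   | refl , refl | _ , refl = inj₂ (GallShaped-unique a d (GallBelow.shaped-left B) (GallBelow.shaped-right B′)
                                         , GallShaped-unique b c (GallBelow.shaped-right B) (GallBelow.shaped-left B′))

  gshaped : ∀ s → GallShaped gedge ε s
  gshaped leaf       = gchildren-spec ε
  gshaped (node a b) = record
    { side-left = side₁ ; side-right = side₂ ; hybrid-vertex = hybrid ; tip-vertex = tip
    ; root-left = left ε ; root-right = right ε
    ; top-children = gchildren-spec ε ; side-left-children = gchildren-spec side₁
    ; side-right-children = gchildren-spec side₂ ; hybrid-children = gchildren-spec hybrid ; tip-childless = gchildren-spec tip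
    ; shaped-left = GallShaped-map {E = gedge} {E′ = gedge {node a b}} left Children-left a (gshaped a)
    ; shaped-right = GallShaped-map {E = gedge} {E′ = gedge {node a b}} right Children-right b (gshaped b) }

  galledGraph-shaped : ∀ s → GallShaped (PositionGraph.graph (galledPositions s)) (PositionGraph.index (galledPositions s) ε) s
  galledGraph-shaped s = GallShaped-map {E = gedge} {E′ = graph} index Children-index s (gshaped s)
    where open PositionGraph (galledPositions s)

  galledGraph-iso⇒≅ : ∀ {s t} → Iso (galledGraph s) (galledGraph t) → s ≅ t
  galledGraph-iso⇒≅ {s} {t} iso@(f , _) = GallShaped-unique s t shaped-s (galledGraph-shaped t)
    where
    module S = PositionGraph (galledPositions s)
    module T = PositionGraph (galledPositions t)
    shaped-s : GallShaped T.graph (T.index ε) s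
    shaped-s = subst (λ x → GallShaped T.graph x s) (iso-root (galledPositions s) (galledPositions t) iso)
      (GallShaped-map {E = S.graph} {E′ = T.graph} (Inverse.to f) (Children-iso {G = S.graph} {H = T.graph} iso) s (galledGraph-shaped s))

module GalledRecognition where

  open import Data.Bool using (true)
  open import Data.Empty using (⊥; ⊥-elim)
  open import Data.Fin using (Fin; zero; suc)
  import Data.Fin.Properties as Fin
  open import Data.List using (List; []; _∷_; [_]; map; length; _++_; allFin; concat; tabulate)
  open import Data.List.Properties using (length-map; length-++; length-tabulate; map-∘)
  open import Data.List.Membership.Propositional using (_∈_; _∉_)
  open import Data.List.Membership.Propositional.Properties
    using (∈-map⁺; ∈-map⁻; ∈-++⁻; ∈-allFin; ∈-concat⁻′; ∈-tabulate⁻)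
  open import Data.List.Relation.Unary.All using ([]; _∷_)
  import Data.List.Relation.Unary.All.Properties as All
  open import Data.List.Relation.Unary.All.Properties using (¬Any⇒All¬)
  open import Data.List.Relation.Unary.AllPairs using ([]; _∷_)
  import Data.List.Relation.Unary.AllPairs.Properties as AllPairs
  open import Data.List.Relation.Unary.Any as Any using (Any; here; there)
  open import Data.List.Relation.Unary.Unique.Propositional using (Unique)
  import Data.List.Relation.Unary.Unique.Propositional.Properties as Unique
  open import Data.Nat using (ℕ; zero; suc; _+_; _*_; _≤_; _<_; z≤n; s≤s; _≟_; _≤?_)
  open import Data.Nat.Properties
    using (≤-refl; ≤-reflexive; ≤-trans; ≤-antisym; ≰⇒>; <-irrefl; <-≤-trans; 1+n≰n; n≮0; +-mono-≤; +-suc; +-assoc; *-comm;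
           suc-injective; +-cancelˡ-≡; +-cancelʳ-≡; *-cancelˡ-≡)
  open import Data.Nat.Tactic.RingSolver using (solve-∀)
  open import Data.Product using (Σ; _×_; _,_; proj₁; proj₂)
  open import Data.Sum using (_⊎_; inj₁; inj₂)
  open import Data.Vec using (Vec) renaming (lookup to vlookup)
  open import Relation.Nullary using (yes; no; ¬_; does)
  open import Function using (case_of_)
  open import Relation.Binary.PropositionalEquality using (_≡_; _≢_; refl; sym; trans; cong; cong₂; subst; subst₂; module ≡-Reasoning)

  open import Defs
  open Counting
  open Digraphs
  open Chains
  open RetCycles
  open Shapes
  open GalledTrees
  open PositionGraphs

  module GallStructure {V : ℕ} (G : Digraph V) (noLoops : NoLoops G) (acyclic : Acyclic G)
    (allowed : ∀ v → AllowedType G v) (r : Fin V) (r-parentless : indeg G r ≡ 0) (only-root : ∀ v → indeg G v ≡ 0 → v ≡ r)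
    (galled : ∀ v (C D : RetCycle G) → OnCycle v C → OnCycle v D → SameCycle C D)
    (timeConsistent : TimeConsistent (V , G)) (simplex : Simplex (V , G))
    (m : ℕ) (leafCount≡ : leafCount (V , G) ≡ 2 * m + 1) (cycles : Vec (RetCycle G) m)
    (cycles-distinct : ∀ i j → i ≢ j → ¬ SameCycle (vlookup cycles i) (vlookup cycles j))
    (cycles-cover : ∀ C → Σ (Fin m) λ i → SameCycle C (vlookup cycles i)) where

    C : Fin m → RetCycle G
    C = vlookup cycles

    same-gall : ∀ {v i j} → OnCycle v (C i) → OnCycle v (C j) → i ≡ j
    same-gall {v} {i} {j} on-i on-j with i Fin.≟ j
    ... | yes i≡j = i≡j
    ... | no i≢j  = ⊥-elim (cycles-distinct i j i≢j (galled v (C i) (C j) on-i on-j))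

    reticulation-gall : ∀ v → indeg G v ≡ 2 → Σ (Fin m) λ i → v ≡ ret (C i)
    reticulation-gall v indeg≡2 with indeg≡2⇒Parents G indeg≡2
    ... | u₁ , u₂ , pa with two-parents⇒RetCycle r (reachable-from-root acyclic r only-root)
                              (Unique-pair⁻ (unique pa)) (sound pa (here refl)) (sound pa (there (here refl)))
    ...   | D , ret≡v with cycles-cover D
    ...     | i , (_ , ret≡ , _) = i , trans (sym ret≡v) ret≡

    gall-reticulation : ∀ i → indeg G (ret (C i)) ≡ 2
    gall-reticulation i with RetCycle-parents acyclic (C i)
    ... | u₁ , u₂ , u₁≢u₂ , e₁ , e₂ =
      ≤-antisym (AllowedDegrees-indeg≤2 (allowed (ret (C i)))) (two-parents⇒2≤indeg G u₁≢u₂ e₁ e₂)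

    reticulations : ListsExactly (λ v → indeg G v ≡ 2) (map (λ i → ret (C i)) (allFin m))
    reticulations = record
      { unique   = Unique.map⁺ (λ {i} {j} ret≡ → same-gall (inj₂ (inj₁ refl)) (inj₂ (inj₁ ret≡))) (Unique.allFin⁺ m)
      ; sound    = sound′
      ; complete = λ {v} indeg≡2 → subst (_∈ _) (sym (proj₂ (reticulation-gall v indeg≡2)))
                     (∈-map⁺ (λ i → ret (C i)) (∈-allFin (proj₁ (reticulation-gall v indeg≡2))))
      }
      where
      sound′ : ∀ {v} → v ∈ map (λ i → ret (C i)) (allFin m) → indeg G v ≡ 2
      sound′ v∈ with ∈-map⁻ (λ i → ret (C i)) v∈
      ... | i , _ , refl = gall-reticulation i

    private
      count-reticulations : count (λ v → indeg G v ≟ 2) ≡ m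
      count-reticulations = trans (count-ListsExactly (λ v → indeg G v ≟ 2) reticulations)
        (trans (length-map (λ i → ret (C i)) (allFin m)) (length-tabulate (λ i → i)))

      count-roots : count (λ v → indeg G v ≟ 0) ≡ 1
      count-roots = count-ListsExactly (λ v → indeg G v ≟ 0) (record
        { unique = [] ∷ [] ; sound = λ { (here refl) → r-parentless } ; complete = λ {v} i≡0 → here (only-root v i≡0) })

      balance : ∑ (outdeg G) + count (λ v → outdeg G v ≟ 0) + count (λ v → indeg G v ≟ 2)
              ≡ ∑ (indeg G) + count (λ v → outdeg G v ≟ 2) + count (λ v → indeg G v ≟ 0)
      balance = begin
        ∑ (outdeg G) + count (λ v → outdeg G v ≟ 0) + count (λ v → indeg G v ≟ 2)
          ≡⟨ cong (_+ count (λ v → indeg G v ≟ 2)) (∑-distrib-+ (outdeg G) (λ v → b2n (does (outdeg G v ≟ 0)))) ⟨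
        ∑ (λ v → outdeg G v + b2n (does (outdeg G v ≟ 0))) + count (λ v → indeg G v ≟ 2)
          ≡⟨ ∑-distrib-+ (λ v → outdeg G v + b2n (does (outdeg G v ≟ 0))) (λ v → b2n (does (indeg G v ≟ 2))) ⟨
        ∑ (λ v → outdeg G v + b2n (does (outdeg G v ≟ 0)) + b2n (does (indeg G v ≟ 2)))
          ≡⟨ sum-cong-≗ (λ v → AllowedDegrees-balance (allowed v)) ⟩
        ∑ (λ v → indeg G v + b2n (does (outdeg G v ≟ 2)) + b2n (does (indeg G v ≟ 0)))
          ≡⟨ ∑-distrib-+ (λ v → indeg G v + b2n (does (outdeg G v ≟ 2))) (λ v → b2n (does (indeg G v ≟ 0))) ⟩
        ∑ (λ v → indeg G v + b2n (does (outdeg G v ≟ 2))) + count (λ v → indeg G v ≟ 0)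
          ≡⟨ cong (_+ count (λ v → indeg G v ≟ 0)) (∑-distrib-+ (indeg G) (λ v → b2n (does (outdeg G v ≟ 2)))) ⟩
        ∑ (indeg G) + count (λ v → outdeg G v ≟ 2) + count (λ v → indeg G v ≟ 0)
          ∎
        where open ≡-Reasoning

      cancel : ∀ E K m → E + (2 * m + 1) + m ≡ E + K + 1 → K ≡ 3 * m
      cancel E K m h = +-cancelʳ-≡ 1 K (3 * m) (+-cancelˡ-≡ E _ _ (trans (sym (+-assoc E K 1)) (trans (sym h) (rearrange E m))))
        where
        rearrange : ∀ E m → E + (2 * m + 1) + m ≡ E + (3 * m + 1)
        rearrange = solve-∀

    count-tree-vertices : count (λ v → outdeg G v ≟ 2) ≡ 3 * m
    count-tree-vertices = cancel (∑ (indeg G)) _ m (begin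
      ∑ (indeg G) + (2 * m + 1) + m
        ≡⟨ cong₂ (λ E ℓ → E + ℓ + m) (handshake G) (trans (sym leafCount≡) (leafCount-count G)) ⟩
      ∑ (outdeg G) + count (λ v → outdeg G v ≟ 0) + m
        ≡⟨ cong (∑ (outdeg G) + count (λ v → outdeg G v ≟ 0) +_) count-reticulations ⟨
      ∑ (outdeg G) + count (λ v → outdeg G v ≟ 0) + count (λ v → indeg G v ≟ 2)
        ≡⟨ balance ⟩
      ∑ (indeg G) + count (λ v → outdeg G v ≟ 2) + count (λ v → indeg G v ≟ 0)
        ≡⟨ cong (∑ (indeg G) + count (λ v → outdeg G v ≟ 2) +_) count-roots ⟩
      ∑ (indeg G) + count (λ v → outdeg G v ≟ 2) + 1
        ∎)
      where open ≡-Reasoning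

    gallVertices : Fin m → List (Fin V)
    gallVertices i = top (C i) ∷ p (C i) ++ q (C i)

    on-gall : ∀ {v} i → v ∈ gallVertices i → OnCycle v (C i)
    on-gall i (here v≡t) = inj₁ v≡t
    on-gall i (there v∈) with ∈-++⁻ (p (C i)) v∈
    ... | inj₁ v∈p = inj₂ (inj₂ (inj₁ v∈p))
    ... | inj₂ v∈q = inj₂ (inj₂ (inj₂ v∈q))

    private
      tail-Unique : ∀ {x : Fin V} {xs} → Unique (x ∷ xs) → Unique xs
      tail-Unique (_ ∷ u) = u

    gallVertices-Unique : ∀ i → Unique (gallVertices i)
    gallVertices-Unique i = ¬Any⇒All¬ _ top∉ ∷ Unique.++⁺ (tail-Unique (chain-Unique acyclic (pathP (C i))))
      (tail-Unique (chain-Unique acyclic (pathQ (C i)))) (λ (v∈p , v∈q) → disjoint (C i) _ v∈p v∈q)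
      where
      top∉ : top (C i) ∉ p (C i) ++ q (C i)
      top∉ t∈ with ∈-++⁻ (p (C i)) t∈
      ... | inj₁ t∈p = source∉chain acyclic (pathP (C i)) t∈p
      ... | inj₂ t∈q = source∉chain acyclic (pathQ (C i)) t∈q

    ret∉gallVertices : ∀ i → ret (C i) ∉ gallVertices i
    ret∉gallVertices i (here r≡t) = chain-source≢target acyclic (pathP (C i)) (sym r≡t)
    ret∉gallVertices i (there r∈) with ∈-++⁻ (p (C i)) r∈
    ... | inj₁ r∈p = target∉chain acyclic (pathP (C i)) r∈p
    ... | inj₂ r∈q = target∉chain acyclic (pathQ (C i)) r∈q

    gallVertices-outdeg : ∀ i {v} → v ∈ gallVertices i → outdeg G v ≡ 2
    gallVertices-outdeg i {v} v∈ = AllowedDegrees-outdeg≡2 (allowed v) (child⇒outdeg≢0 G (proj₂ (child v∈))) not-reticulation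
      where
      child : ∀ {v} → v ∈ gallVertices i → Σ (Fin V) λ w → G v w ≡ true
      child (here refl) = chain-first (pathP (C i))
      child (there v∈) with ∈-++⁻ (p (C i)) v∈
      ... | inj₁ v∈p = chain-first (proj₂ (chain-suffix (pathP (C i)) v∈p))
      ... | inj₂ v∈q = chain-first (proj₂ (chain-suffix (pathQ (C i)) v∈q))
      not-reticulation : indeg G v ≢ 2
      not-reticulation indeg≡2 = ret∉gallVertices i (subst (_∈ gallVertices i) v≡ret v∈)
        where
        gall = reticulation-gall v indeg≡2
        v≡ret : v ≡ ret (C i)
        v≡ret = trans (proj₂ gall) (cong (λ k → ret (C k)) (same-gall (inj₂ (inj₁ (proj₂ gall))) (on-gall i v∈)))

    gallVertices-length : ∀ i → 3 ≤ length (gallVertices i)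
    gallVertices-length i = s≤s (subst (2 ≤_) (sym (length-++ (p (C i))))
      (+-mono-≤ (nonempty (proj₁ (timeConsistent (C i)))) (nonempty (proj₂ (timeConsistent (C i))))))
      where
      nonempty : ∀ {xs : List (Fin V)} → xs ≢ [] → 1 ≤ length xs
      nonempty {[]}    xs≢[] = ⊥-elim (xs≢[] refl)
      nonempty {_ ∷ _} _     = s≤s z≤n

    private
      length-concat-tabulate : ∀ {k} (f : Fin k → List (Fin V)) → length (concat (tabulate f)) ≡ ∑ (λ i → length (f i))
      length-concat-tabulate {zero}  f = refl
      length-concat-tabulate {suc k} f =
        trans (length-++ (f zero)) (cong (length (f zero) +_) (length-concat-tabulate (λ i → f (suc i))))

    allGallVertices : List (Fin V)
    allGallVertices = concat (tabulate gallVertices)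

    allGallVertices-Unique : Unique allGallVertices
    allGallVertices-Unique = Unique.concat⁺ (All.tabulate⁺ gallVertices-Unique)
      (AllPairs.tabulate⁺ λ {i} {j} i≢j (v∈i , v∈j) → i≢j (same-gall (on-gall i v∈i) (on-gall j v∈j)))

    ∈-allGallVertices⁻ : ∀ {v} → v ∈ allGallVertices → Σ (Fin m) λ i → v ∈ gallVertices i
    ∈-allGallVertices⁻ v∈ with ∈-concat⁻′ (tabulate gallVertices) v∈
    ... | xs , v∈xs , xs∈ with ∈-tabulate⁻ xs∈
    ...   | i , refl = i , v∈xs

    private
      ∑-gallVertices : ∑ (λ i → length (gallVertices i)) ≤ 3 * m
      ∑-gallVertices = subst₂ _≤_ (length-concat-tabulate gallVertices) count-tree-vertices
        (length≤count (λ v → outdeg G v ≟ 2) allGallVertices-Unique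
          (λ v∈ → gallVertices-outdeg (proj₁ (∈-allGallVertices⁻ v∈)) (proj₂ (∈-allGallVertices⁻ v∈))))

      ∑-three : ∑ {m} (λ _ → 3) ≡ 3 * m
      ∑-three = trans (∑-const m 3) (*-comm m 3)

    -- The m galls are disjoint and each holds at least three of the 3m vertices of out-degree 2.
    gallVertices-length≡3 : ∀ i → length (gallVertices i) ≡ 3
    gallVertices-length≡3 i with length (gallVertices i) ≤? 3
    ... | yes ≤3 = ≤-antisym ≤3 (gallVertices-length i)
    ... | no ≰3  = ⊥-elim (<-irrefl refl (<-≤-trans (subst (_< ∑ (λ j → length (gallVertices j))) ∑-three (∑-mono-< {f = λ _ → 3} gallVertices-length i (≰⇒> ≰3))) ∑-gallVertices))

    tree-vertex-in-gall : ∀ {v} → outdeg G v ≡ 2 → Σ (Fin m) λ i → v ∈ gallVertices i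
    tree-vertex-in-gall o≡2 = ∈-allGallVertices⁻ (complete-by-count (λ v → outdeg G v ≟ 2) allGallVertices-Unique
      (λ v∈ → gallVertices-outdeg (proj₁ (∈-allGallVertices⁻ v∈)) (proj₂ (∈-allGallVertices⁻ v∈)))
      (subst₂ _≤_ (sym count-tree-vertices) (trans (sym (sum-cong-≗ gallVertices-length≡3)) (sym (length-concat-tabulate gallVertices)))
        (≤-reflexive (sym ∑-three)))
      o≡2)

    private
      singletons : ∀ (xs ys : List (Fin V)) → xs ≢ [] → ys ≢ [] → length xs + length ys ≡ 2 →
        Σ (Fin V) λ a → Σ (Fin V) λ b → xs ≡ [ a ] × ys ≡ [ b ]
      singletons []           _            xs≢[] _     _ = ⊥-elim (xs≢[] refl)
      singletons (_ ∷ _)      []           _     ys≢[] _ = ⊥-elim (ys≢[] refl)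
      singletons (a ∷ [])     (b ∷ [])     _     _     _ = a , b , refl , refl
      singletons (a ∷ [])     (b ∷ _ ∷ _)  _     _     ()
      singletons (a ∷ _ ∷ xs) (b ∷ ys)     _     _     e with trans (sym (+-suc (length xs) (length ys))) (suc-injective (suc-injective e))
      ... | ()

    -- Opaque, so that the two sides of a gall never unfold into the counting argument that produced them.
    opaque
      sides : ∀ i → Σ (Fin V) λ a → Σ (Fin V) λ b → p (C i) ≡ [ a ] × q (C i) ≡ [ b ]
      sides i = singletons (p (C i)) (q (C i)) (proj₁ (timeConsistent (C i))) (proj₂ (timeConsistent (C i)))
        (suc-injective (trans (cong suc (sym (length-++ (p (C i))))) (gallVertices-length≡3 i)))

    left-side right-side : Fin m → Fin V
    left-side i = proj₁ (sides i)
    right-side i = proj₁ (proj₂ (sides i))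

    private
      singleton-chain : ∀ {s a t} → Chain G s [ a ] t → G s a ≡ true × G a t ≡ true
      singleton-chain (step e (direct e′)) = e , e′

    gall-edges : ∀ i → (G (top (C i)) (left-side i) ≡ true × G (left-side i) (ret (C i)) ≡ true) ×
                       (G (top (C i)) (right-side i) ≡ true × G (right-side i) (ret (C i)) ≡ true)
    gall-edges i with sides i
    ... | a , b , p≡ , q≡ = singleton-chain (subst (λ xs → Chain G (top (C i)) xs (ret (C i))) p≡ (pathP (C i)))
                          , singleton-chain (subst (λ xs → Chain G (top (C i)) xs (ret (C i))) q≡ (pathQ (C i)))

    gallVertices≡ : ∀ i → gallVertices i ≡ top (C i) ∷ left-side i ∷ right-side i ∷ []
    gallVertices≡ i with sides i
    ... | a , b , p≡ , q≡ = cong (top (C i) ∷_) (cong₂ _++_ p≡ q≡)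

    left-side≢right-side : ∀ i → left-side i ≢ right-side i
    left-side≢right-side i a≡b with sides i
    ... | a , b , p≡ , q≡ = disjoint (C i) a (subst (a ∈_) (sym p≡) (here refl)) (subst (a ∈_) (sym q≡) (here a≡b))

    ret-parents : ∀ i → Parents G (ret (C i)) (left-side i ∷ right-side i ∷ [])
    ret-parents i = Parents-by-indeg G (Unique-pair (left-side≢right-side i))
      (λ { (here refl) → proj₂ (proj₁ (gall-edges i)) ; (there (here refl)) → proj₂ (proj₂ (gall-edges i)) })
      (≤-reflexive (gall-reticulation i))

    private
      ∈-gallVertices : ∀ {i v} → v ∈ gallVertices i → v ≡ top (C i) ⊎ v ≡ left-side i ⊎ v ≡ right-side i
      ∈-gallVertices {i} {v} v∈ with subst (v ∈_) (gallVertices≡ i) v∈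
      ... | here v≡t                 = inj₁ v≡t
      ... | there (here v≡a)         = inj₂ (inj₁ v≡a)
      ... | there (there (here v≡b)) = inj₂ (inj₂ v≡b)

      left-side∈ : ∀ i → left-side i ∈ gallVertices i
      left-side∈ i = subst (left-side i ∈_) (sym (gallVertices≡ i)) (there (here refl))

      right-side∈ : ∀ i → right-side i ∈ gallVertices i
      right-side∈ i = subst (right-side i ∈_) (sym (gallVertices≡ i)) (there (there (here refl)))

      parent-unique : ∀ {u u′ v} → outdeg G v ≢ 1 → G u v ≡ true → G u′ v ≡ true → u ≡ u′
      parent-unique {u} {u′} {v} o≢1 e e′ with u Fin.≟ u′
      ... | yes u≡u′ = u≡u′
      ... | no u≢u′  = ⊥-elim (1+n≰n (≤-trans (two-parents⇒2≤indeg G u≢u′ e e′) (AllowedDegrees-indeg≤1 (allowed v) o≢1)))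

      2≢1 : 2 ≢ 1
      2≢1 ()

    Good : Fin V → Set
    Good x = outdeg G x ≡ 0 ⊎ Σ (Fin m) λ i → x ≡ top (C i)

    private
      tree-vertex-good : ∀ {x u} → outdeg G x ≡ 2 → G u x ≡ true → (∀ j → u ≢ top (C j)) → Good x
      tree-vertex-good {x} {u} o≡2 u→x u-not-top = classify (proj₁ located) (∈-gallVertices (proj₂ located))
        where
        located : Σ (Fin m) λ j → x ∈ gallVertices j
        located = tree-vertex-in-gall o≡2
        o≢1 : outdeg G x ≢ 1
        o≢1 o≡1 = 2≢1 (trans (sym o≡2) o≡1)
        entered-from-top : ∀ {j} → G (top (C j)) x ≡ true → ⊥
        entered-from-top {j} t→x = u-not-top j (parent-unique o≢1 u→x t→x)
        classify : ∀ j → x ≡ top (C j) ⊎ x ≡ left-side j ⊎ x ≡ right-side j → Good x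
        classify j (inj₁ x≡t)        = inj₂ (j , x≡t)
        classify j (inj₂ (inj₁ x≡a)) = ⊥-elim (entered-from-top (subst (λ y → G (top (C j)) y ≡ true) (sym x≡a) (proj₁ (proj₁ (gall-edges j)))))
        classify j (inj₂ (inj₂ x≡b)) = ⊥-elim (entered-from-top (subst (λ y → G (top (C j)) y ≡ true) (sym x≡b) (proj₁ (proj₂ (gall-edges j)))))

      subtree-root-good : ∀ i {a c} → a ∈ gallVertices i → a ≢ top (C i) → G a c ≡ true → c ≢ ret (C i) → Good c
      subtree-root-good i {a} {c} a∈ a≢t a→c c≢h = case outdeg G c ≟ 0 of λ
        { (yes o≡0) → inj₁ o≡0
        ; (no o≢0)  → tree-vertex-good (AllowedDegrees-outdeg≡2 (allowed c) o≢0 not-reticulation) a→c a-not-top }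
        where
        a-not-top : ∀ j → a ≢ top (C j)
        a-not-top j a≡t = a≢t (subst (λ k → a ≡ top (C k)) (same-gall (inj₁ a≡t) (on-gall i a∈)) a≡t)
        not-reticulation : indeg G c ≢ 2
        not-reticulation indeg≡2 = c≢h (trans c≡ret (cong (λ k → ret (C k)) (same-gall (a-on-gall (ListsExactly-pair (ret-parents j) a→ret)) (on-gall i a∈))))
          where
          j = proj₁ (reticulation-gall c indeg≡2)
          c≡ret : c ≡ ret (C j)
          c≡ret = proj₂ (reticulation-gall c indeg≡2)
          a→ret : G a (ret (C j)) ≡ true
          a→ret = subst (λ x → G a x ≡ true) c≡ret a→c
          a-on-gall : a ≡ left-side j ⊎ a ≡ right-side j → OnCycle a (C j)
          a-on-gall (inj₁ a≡) = on-gall j (subst (_∈ gallVertices j) (sym a≡) (left-side∈ j))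
          a-on-gall (inj₂ a≡) = on-gall j (subst (_∈ gallVertices j) (sym a≡) (right-side∈ j))

    root-good : Good r
    root-good = classify (proj₁ located) (∈-gallVertices (proj₂ located))
      where
      located : Σ (Fin m) λ j → r ∈ gallVertices j
      located = tree-vertex-in-gall (AllowedDegrees-root (allowed r) r-parentless)
      entered : ∀ {u} → G u r ≡ true → ⊥
      entered u→r with complete (indeg≡0⇒Parentless G r-parentless) u→r
      ... | ()
      classify : ∀ j → r ≡ top (C j) ⊎ r ≡ left-side j ⊎ r ≡ right-side j → Good r
      classify j (inj₁ r≡t)        = inj₂ (j , r≡t)
      classify j (inj₂ (inj₁ r≡a)) = ⊥-elim (entered (subst (λ y → G (top (C j)) y ≡ true) (sym r≡a) (proj₁ (proj₁ (gall-edges j)))))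
      classify j (inj₂ (inj₂ r≡b)) = ⊥-elim (entered (subst (λ y → G (top (C j)) y ≡ true) (sym r≡b) (proj₁ (proj₂ (gall-edges j)))))

    module _ (i : Fin m) where
      private
        t : Fin V
        t = top (C i)
        h : Fin V
        h = ret (C i)

        side-split : ∀ {a} → a ∈ gallVertices i → G a h ≡ true → Σ (Fin V) λ c → Children G a (h ∷ c ∷ [])
        side-split a∈ a→h = Children-with {E = G} (proj₂ (proj₂ (outdeg≡2⇒Children G (gallVertices-outdeg i a∈)))) a→h

        side≢top : ∀ {a} → G t a ≡ true → a ≢ t
        side≢top t→a a≡t = chain-source≢target acyclic (direct t→a) (sym a≡t)

        subtree-good : ∀ {a} → a ∈ gallVertices i → G t a ≡ true → (split : Σ (Fin V) λ c → Children G a (h ∷ c ∷ [])) →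
          Good (proj₁ split)
        subtree-good a∈ t→a (c , ch) = subtree-root-good i a∈ (side≢top t→a) (sound ch (there (here refl)))
          (λ c≡h → Unique-pair⁻ (unique ch) (sym c≡h))

        hybrid-child : Σ (Fin V) λ ℓ → Children G h [ ℓ ]
        hybrid-child = outdeg≡1⇒Children G (AllowedDegrees-hybrid (allowed h) (gall-reticulation i))

      frame : GallBelow G t Good Good
      frame = record
        { side-left = left-side i ; side-right = right-side i ; hybrid-vertex = h ; tip-vertex = proj₁ hybrid-child
        ; root-left = proj₁ split₁ ; root-right = proj₁ split₂
        ; top-children = Children-by-outdeg G (Unique-pair (left-side≢right-side i))
            (λ { (here refl) → proj₁ (proj₁ (gall-edges i)) ; (there (here refl)) → proj₁ (proj₂ (gall-edges i)) })
            (≤-reflexive (gallVertices-outdeg i (here refl)))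
        ; side-left-children = proj₂ split₁ ; side-right-children = proj₂ split₂
        ; hybrid-children = proj₂ hybrid-child
        ; tip-childless = outdeg≡0⇒Childless G (simplex h (proj₁ hybrid-child) (gall-reticulation i) (sound (proj₂ hybrid-child) (here refl)))
        ; shaped-left  = subtree-good (left-side∈ i) (proj₁ (proj₁ (gall-edges i))) split₁
        ; shaped-right = subtree-good (right-side∈ i) (proj₁ (proj₂ (gall-edges i))) split₂
        }
        where
        split₁ = side-split (left-side∈ i) (proj₂ (proj₁ (gall-edges i)))
        split₂ = side-split (right-side∈ i) (proj₂ (proj₂ (gall-edges i)))

    shape-below : ∀ k x → Height {G = G} x k → Good x → Σ Shape λ s → GallShaped G x s
    shape-below k       x h (inj₁ o≡0)       = leaf , outdeg≡0⇒Childless G o≡0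
    shape-below zero    x h (inj₂ (i , refl)) = ⊥-elim (n≮0 (h (direct (proj₁ (proj₁ (gall-edges i))))))
    shape-below (suc k) x h (inj₂ (i , refl)) = node (proj₁ L) (proj₁ R) , record
      { side-left = side-left ; side-right = side-right ; hybrid-vertex = hybrid-vertex ; tip-vertex = tip-vertex
      ; root-left = root-left ; root-right = root-right
      ; top-children = top-children ; side-left-children = side-left-children ; side-right-children = side-right-children
      ; hybrid-children = hybrid-children ; tip-childless = tip-childless
      ; shaped-left = proj₂ L ; shaped-right = proj₂ R }
      where
      open GallBelow (frame i)
      L : Σ Shape λ a → GallShaped G root-left a
      L = shape-below k root-left (Height-grandchild h (sound top-children (here refl)) (sound side-left-children (there (here refl)))) shaped-left
      R : Σ Shape λ b → GallShaped G root-right b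
      R = shape-below k root-right (Height-grandchild h (sound top-children (there (here refl))) (sound side-right-children (there (here refl)))) shaped-right

  module GallEmbedding {V : ℕ} (G : Digraph V) (acyclic : Acyclic G) (r : Fin V)
    (r-parentless : indeg G r ≡ 0) (only-root : ∀ v → indeg G v ≡ 0 → v ≡ r)
    (indeg≤2 : ∀ v → indeg G v ≤ 2) (indeg≤1 : ∀ v → outdeg G v ≢ 1 → indeg G v ≤ 1) where

    embed : ∀ s {x} → GallShaped G x s → GPos s → Fin V
    embed s          {x} _ ε         = x
    embed (node a b)     B side₁     = GallBelow.side-left B
    embed (node a b)     B side₂     = GallBelow.side-right B
    embed (node a b)     B hybrid    = GallBelow.hybrid-vertex B
    embed (node a b)     B tip       = GallBelow.tip-vertex B
    embed (node a b)     B (left p)  = embed a (GallBelow.shaped-left B) p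
    embed (node a b)     B (right p) = embed b (GallBelow.shaped-right B) p

    embed-children : ∀ s {x} (sh : GallShaped G x s) p → Children G (embed s sh p) (map (embed s sh) (gchildren p))
    embed-children leaf       sh ε         = sh
    embed-children (node a b) B  ε         = GallBelow.top-children B
    embed-children (node a b) B  side₁     = GallBelow.side-left-children B
    embed-children (node a b) B  side₂     = GallBelow.side-right-children B
    embed-children (node a b) B  hybrid    = GallBelow.hybrid-children B
    embed-children (node a b) B  tip       = GallBelow.tip-childless B
    embed-children (node a b) B  (left p)  =
      subst (Children G _) (map-∘ (gchildren p)) (embed-children a (GallBelow.shaped-left B) p)
    embed-children (node a b) B  (right p) =
      subst (Children G _) (map-∘ (gchildren p)) (embed-children b (GallBelow.shaped-right B) p)

    iso-of-shaped : ∀ s → GallShaped G r s → Iso (V , G) (galledGraph s)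
    iso-of-shaped s sh = Embedding.iso G emb (embed-children s sh) emb-parents (reachable-from-root acyclic r only-root)
      where
      open PositionGraph (galledPositions s) using (Parents-embedding; module Embedding)
      emb = embed s sh
      outdeg-emb : ∀ p → outdeg G (emb p) ≡ length (gchildren p)
      outdeg-emb p = trans (outdeg-Children G (embed-children s sh p)) (length-map emb (gchildren p))
      parents-nonempty : ∀ p → p ≢ ε → length (gparents p) ≢ 0
      parents-nonempty p p≢ε len≡0 = p≢ε (gparents-rooted p (length≡0 len≡0))
      hybrid-parents : ∀ p → length (gparents p) ≡ 2 → Unique (map emb (gparents p))
      hybrid-parents p len≡2 with two-parents⇒hybrid p (≤-reflexive (sym len≡2))
      ... | g , refl = subst (λ ps → Unique (map emb ps)) (sym (gparents-hybrid g))
        (subst (λ cs → Unique (map emb cs)) (gchildren-top g) (unique (embed-children s sh (at g ε))))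
      emb-parents : ∀ p → Parents G (emb p) (map emb (gparents p))
      emb-parents p with is-ε? p
      ... | yes refl = indeg≡0⇒Parentless G r-parentless
      ... | no p≢ε with length (gparents p) ≟ 2
      ...   | yes len≡2 = Parents-embedding G emb (embed-children s sh) p (hybrid-parents p len≡2)
                            (subst (indeg G (emb p) ≤_) (sym len≡2) (indeg≤2 (emb p)))
      ...   | no len≢2  = Parents-embedding G emb (embed-children s sh) p
                            (Unique-length≡1 (trans (length-map emb (gparents p)) len≡1))
                            (subst (indeg G (emb p) ≤_) (sym len≡1)
                              (indeg≤1 (emb p) (λ o≡1 → AllowedDegrees-outdeg≢1 (gdegrees p p≢ε) len≢2 (trans (sym (outdeg-emb p)) o≡1))))
        where
        len≡1 : length (gparents p) ≡ 1
        len≡1 = AllowedDegrees-indeg≡1 (gdegrees p p≢ε) (parents-nonempty p p≢ε) len≢2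

  private
    network-degrees : ∀ {V} {G : Digraph V} → IsNetwork (V , G) →
      (∀ v → indeg G v ≤ 2) × (∀ v → outdeg G v ≢ 1 → indeg G v ≤ 1)
    network-degrees {G = G} (noLoops , _ , inj₁ refl) =
      (λ v → subst (_≤ 2) (sym (single-vertex-indeg {G = G} noLoops v)) z≤n) ,
      (λ v _ → subst (_≤ 1) (sym (single-vertex-indeg {G = G} noLoops v)) z≤n)
    network-degrees (_ , _ , inj₂ (allowed , _)) =
      (λ v → AllowedDegrees-indeg≤2 (allowed v)) , (λ v → AllowedDegrees-indeg≤1 (allowed v))

    root-shape : ∀ m {V} {G : Digraph V} → SimplexTCGalled (2 * m + 1) m (V , G) →
      ∀ r → indeg G r ≡ 0 → (∀ v → indeg G v ≡ 0 → v ≡ r) → Σ Shape λ s → GallShaped G r s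
    root-shape m {G = G} (((noLoops , _ , inj₁ refl) , _) , _) r _ _ =
      leaf , outdeg≡0⇒Childless G (single-vertex-outdeg {G = G} noLoops r)
    root-shape m {V} {G} (((noLoops , acyclic , inj₂ (allowed , _)) , galled) , tc , simplex , leafCount≡ , cycles , distinct , cover)
      r r-parentless only-root = shape-below V r (Height-bounded acyclic r) root-good
      where open GallStructure G noLoops acyclic allowed r r-parentless only-root galled tc simplex m leafCount≡ cycles distinct cover

  galledGraph-complete : ∀ m H → SimplexTCGalled (2 * m + 1) m H → Any (λ s → Iso H (galledGraph s)) (shapeClasses m)
  galledGraph-complete m (V , G) H@(((network@(_ , acyclic , _) , _) , _ , _ , leafCount≡ , _)) =
    Any.map (λ s≅u → iso-of-shaped _ (GallShaped-≅ s _ s≅u shaped)) (shapeClasses-complete s leaves-s)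
    where
    root = network-root network
    r = proj₁ root
    degrees = network-degrees network
    open GallEmbedding G acyclic r (proj₁ (proj₂ root)) (proj₂ (proj₂ root)) (proj₁ degrees) (proj₂ degrees)
    built = root-shape m H r (proj₁ (proj₂ root)) (proj₂ (proj₂ root))
    s = proj₁ built
    shaped = proj₂ built
    internal-s : internal s ≡ m
    internal-s = *-cancelˡ-≡ (internal s) m 2 (+-cancelʳ-≡ 1 (2 * internal s) (2 * m)
      (trans (sym (galledGraph-leafCount s)) (trans (leafCount-iso (iso-of-shaped s shaped)) leafCount≡)))
    leaves-s : leaves s ≡ suc m
    leaves-s = trans (leaves≡1+internal s) (cong suc internal-s)

open import Data.Nat using (ℕ; suc; _+_; _*_)
open import Data.Nat.Properties using (suc-injective)
open import Data.List using (length)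
open import Data.Product using (Σ; _×_; _,_)
open import Relation.Binary.PropositionalEquality using (sym; trans)
open import Defs
open Shapes
open BinaryTrees using (treeGraph; treeGraph-binary; treeGraph-leafCount; treeGraph-iso⇒≅; treeGraph-complete)
open GalledTrees using (galledGraph; galledGraph-SimplexTCGalled; galledGraph-iso⇒≅)
open GalledRecognition using (galledGraph-complete)

proposition9 : (m : ℕ) →
    Σ ℕ (λ k → ClassCount (SimplexTCGalled (2 * m + 1) m) k × ClassCount (BinTree (suc m)) k)
proposition9 m = length (shapeClasses m) , galled-classes , tree-classes
  where
  galled-classes : ClassCount (SimplexTCGalled (2 * m + 1) m) (length (shapeClasses m))
  galled-classes = classCount (SimplexTCGalled (2 * m + 1) m) galledGraph (shapeClasses m) (shapeClasses-distinct m)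
    (λ {s} s∈ → galledGraph-SimplexTCGalled s m (suc-injective (trans (sym (leaves≡1+internal s)) (shapeClasses-leaves s∈))))
    galledGraph-iso⇒≅ (galledGraph-complete m)
  tree-classes : ClassCount (BinTree (suc m)) (length (shapeClasses m))
  tree-classes = classCount (BinTree (suc m)) treeGraph (shapeClasses m) (shapeClasses-distinct m)
    (λ {s} s∈ → treeGraph-binary s , trans (treeGraph-leafCount s) (shapeClasses-leaves s∈))
    treeGraph-iso⇒≅ (treeGraph-complete m)
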